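{- For all $n \geq 1$, $$qq(n)+\sum_{j\ge1}(-1)^j\Big(qq\big(n-2j(3j-1)\big)+qq\big(n-2j(3j+1)\big)\Big) = qq(n)-qq(n-4)-qq(n-8)+qq(n-20)+qq(n-28)-\cdots = \begin{cases}1, & \text{if } n \text{ is a triangular number},\\ 0, & \text{otherwise.}\end{cases}$$
   Context: $qq(n)$ denotes the number of partitions of $n$ into distinct odd parts, with $qq(0)=1$ and $qq(m)=0$ for $m<0$. Triangular numbers are the numbers $k(k+1)/2$, $k\ge 0$. -}

module Defs where

open import Data.Nat using (ℕ; zero; suc; _+_; _*_; _∸_; _≤?_; _≟_)
open import Data.Nat.DivMod using (_%_)
open import Data.List using (List; []; _∷_; length; map; concatMap; upTo)
open import Data.Integer using (ℤ; +_; -[1+_]; _-_) renaming (_+_ to _+ℤ_; _*_ to _*ℤ_)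
open import Data.Product using (∃-syntax)
open import Relation.Binary.PropositionalEquality using (_≡_)
open import Relation.Nullary using (yes; no)

-- dpartsBelow b m : all partitions of m into distinct odd parts, each part < b,
-- listed as strictly decreasing lists of parts.
dpartsBelow : ℕ → ℕ → List (List ℕ)
dpartsBelow zero zero = [] ∷ []
dpartsBelow zero (suc m) = []
dpartsBelow (suc b) m with b % 2 ≟ 1 | b ≤? m
... | yes _ | yes _ = map (b ∷_) (dpartsBelow b (m ∸ b)) Data.List.++ dpartsBelow b m
... | _     | _     = dpartsBelow b m

distinctOddPartitions : ℕ → List (List ℕ)
distinctOddPartitions n = dpartsBelow (suc n) n

qqℕ : ℕ → ℕ
qqℕ n = length (distinctOddPartitions n)

qq : ℤ → ℤ
qq (+ n) = + qqℕ n
qq -[1+ m ] = + 0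

sgn : ℕ → ℤ
sgn zero = + 1
sgn (suc zero) = -[1+ 0 ]
sgn (suc (suc j)) = sgn j

-- Σ_{j=1}^{N} (-1)^j ( qq(n - 2j(3j-1)) + qq(n - 2j(3j+1)) )
-- (for j ≥ 1, 3j-1 in ℕ is exact)
term : ℕ → ℕ → ℤ
term n j = sgn j *ℤ (qq (+ n - + (2 * j * (3 * j ∸ 1))) +ℤ qq (+ n - + (2 * j * (3 * j + 1))))

partialSum : ℕ → ℕ → ℤ
partialSum n zero = + 0
partialSum n (suc N) = partialSum n N +ℤ term n (suc N)

-- The series Σ_{j≥1}; all terms with j > n vanish (2j(3j-1) > n), so truncating at j = n
-- gives the full (finite) sum.
lhs : ℕ → ℤ
lhs n = qq (+ n) +ℤ partialSum n n

Triangular : ℕ → Set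
Triangular n = ∃[ k ] (2 * n ≡ k * (k + 1))

module Submission where

-- Let Q(q) = ∏_{k≥1} (1 + q^{2k-1}) = Σ qq(n) qⁿ.  The left-hand side is the coefficient of
-- qⁿ in Q(q) · Σ_{j∈ℤ} (-1)^j q^{2j(3j-1)}, and we show that this product is Σ_{k≥0} q^{T(k)},
-- T(k) = k(k+1)/2.  Both steps are cases of Jacobi's triple product identity
--   ∏_{k≥1} (1 - q^{ck}) (1 + ε q^{ck-u}) (1 + ε q^{ck-w}) = Σ_{j∈ℤ} ε^j q^{c T(j) - w j}
-- (c = u + w, ε = ±1): c = 12, w = 8, ε = -1 is Euler's pentagonal theorem for
-- E(q⁴) = ∏ (1 - q^{4k}), and c = 4, w = 1, ε = 1 is Gauss' identity Q(q) E(q⁴) = Σ_k q^{T(k)}.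
-- Series are coefficient functions ℤ → ℤ, multiplication by a binomial 1 + σ q^e is an
-- operation on them, and identities are proved modulo q^L.  For the triple product, the
-- x-coefficients of ∏_{n≤N} (1 + x q^{cn}) ∏_{k<K} (x + q^{ck}) obey a finite q-binomial law
-- (two Pascal recurrences); cancelling (q^c;q^c)-factors on series supported on ℕ makes each
-- coefficient a single power of q modulo q^L, and x = ε q^{-w} gives the identity.

open import Defs
open import Data.Nat using (ℕ; _≥_)
open import Data.Integer using (ℤ; +_)
open import Relation.Binary.PropositionalEquality using (_≡_)
open import Relation.Nullary using (¬_)
open import Data.Product using (_×_)

open import Level using (0ℓ)
open import Data.Nat as N using (zero; suc; z≤n; s≤s; _≤′_; ≤′-refl; ≤′-step)
import Data.Nat.Properties as NP
import Data.Nat.Tactic.RingSolver as NatSolver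
open import Data.Integer using (-[1+_]; _+_; _-_; _*_; -_; _^_; ∣_∣; _<_; _≤_; +<+; +≤+; -<+)
import Data.Integer.Properties as ZP
open import Data.Integer.Tactic.RingSolver using (solve-∀)
open import Data.List using (List; []; _∷_; map; length; _++_)
open import Data.Nat.DivMod using (_%_; [m+kn]%n≡m%n)
import Data.List.Properties as LP
open import Data.List.Relation.Unary.All using (All; []; _∷_)
open import Data.Product using (_,_; proj₂; Σ-syntax)
open import Data.Sum using (_⊎_; inj₁; inj₂)
open import Data.Empty using (⊥-elim)
open import Relation.Nullary using (yes; no)
open import Relation.Binary.PropositionalEquality
  using (refl; sym; trans; cong; cong₂; subst; _≢_; _≗_; module ≡-Reasoning)
open import Relation.Binary.Bundles using (Setoid)
import Relation.Binary.Reasoning.Setoid as SetoidReasoning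
open import Function using (_∘_)

-- A series is the coefficient function m ↦ [q^m] of a formal Laurent series in q;
-- series are compared pointwise (_≗_).
Series : Set
Series = ℤ → ℤ

seriesSetoid : Setoid 0ℓ 0ℓ
seriesSetoid = record
  { Carrier = Series
  ; _≈_ = _≗_
  ; isEquivalence = record
    { refl = λ _ → refl
    ; sym = λ p m → sym (p m)
    ; trans = λ p q m → trans (p m) (q m)
    }
  }

open Setoid seriesSetoid using () renaming (refl to ≗-refl; sym to ≗-sym; trans to ≗-trans)
module ≗-Reasoning = SetoidReasoning seriesSetoid

𝟘 𝟙 : Series
𝟘 _ = + 0
𝟙 (+ zero) = + 1
𝟙 (+ suc _) = + 0
𝟙 -[1+ _ ] = + 0

shift : ℤ → Series → Series
shift e f m = f (m - e)

infixl 6 _⊕_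
_⊕_ : Series → Series → Series
(f ⊕ g) m = f m + g m

infixr 7 _·_
_·_ : ℤ → Series → Series
(c · f) m = c * f m

-- factor σ e f is (1 + σ q^e) · f, the only kind of multiplication the proof needs.
factor : ℤ → ℕ → Series → Series
factor σ e f m = f m + σ * f (m - + e)

Factor : Set
Factor = ℤ × ℕ

prod : List Factor → Series → Series
prod [] f = f
prod ((σ , e) ∷ fs) f = factor σ e (prod fs f)

shift-cong : ∀ e {f g} → f ≗ g → shift e f ≗ shift e g
shift-cong e p m = p (m - e)

factor-cong : ∀ σ e {f g} → f ≗ g → factor σ e f ≗ factor σ e g
factor-cong σ e p m = cong₂ (λ a b → a + σ * b) (p m) (p (m - + e))

prod-cong : ∀ fs {f g} → f ≗ g → prod fs f ≗ prod fs g
prod-cong [] p = p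
prod-cong ((σ , e) ∷ fs) p = factor-cong σ e (prod-cong fs p)

⊕-cong : ∀ {f f′ g g′} → f ≗ f′ → g ≗ g′ → f ⊕ g ≗ f′ ⊕ g′
⊕-cong p q m = cong₂ _+_ (p m) (q m)

⊕-congˡ : ∀ {f f′} g → f ≗ f′ → f ⊕ g ≗ f′ ⊕ g
⊕-congˡ g p m = cong (λ x → x + g m) (p m)

⊕-congʳ : ∀ f {g g′} → g ≗ g′ → f ⊕ g ≗ f ⊕ g′
⊕-congʳ f p m = cong (λ x → f m + x) (p m)

·-cong : ∀ c {f g} → f ≗ g → c · f ≗ c · g
·-cong c p m = cong (c *_) (p m)

shift-≡ : ∀ {d e} f → d ≡ e → shift d f ≗ shift e f
shift-≡ f refl = ≗-refl

factor-≡ : ∀ σ {d e} f → d ≡ e → factor σ d f ≗ factor σ e f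
factor-≡ σ f refl = ≗-refl

⊕-identityˡ : ∀ f → 𝟘 ⊕ f ≗ f
⊕-identityˡ f m = ZP.+-identityˡ (f m)

⊕-identityʳ : ∀ f → f ⊕ 𝟘 ≗ f
⊕-identityʳ f m = ZP.+-identityʳ (f m)

⊕-comm : ∀ f g → f ⊕ g ≗ g ⊕ f
⊕-comm f g m = ZP.+-comm (f m) (g m)

·-⊕ : ∀ c f g → c · (f ⊕ g) ≗ c · f ⊕ c · g
·-⊕ c f g m = ZP.*-distribˡ-+ c (f m) (g m)

shift-zero : ∀ f → shift (+ 0) f ≗ f
shift-zero f m = cong f (ZP.+-identityʳ m)

shift-shift : ∀ d e f → shift d (shift e f) ≗ shift (d + e) f
shift-shift d e f m = cong f (lemma m d e)
  where
  lemma : ∀ m d e → m - d - e ≡ m - (d + e)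
  lemma = solve-∀

private
  swap-exponents : ∀ m a b → m - a - b ≡ m - b - a
  swap-exponents = solve-∀

factor-comm : ∀ σ d τ e f → factor σ d (factor τ e f) ≗ factor τ e (factor σ d f)
factor-comm σ d τ e f m rewrite swap-exponents m (+ d) (+ e) =
  lemma σ τ (f m) (f (m - + d)) (f (m - + e)) (f (m - + e - + d))
  where
  lemma : ∀ σ τ a b c x → a + τ * c + σ * (b + τ * x) ≡ a + σ * b + τ * (c + σ * x)
  lemma = solve-∀

factor-⊕ : ∀ σ e f g → factor σ e (f ⊕ g) ≗ factor σ e f ⊕ factor σ e g
factor-⊕ σ e f g m = lemma σ (f m) (g m) (f (m - + e)) (g (m - + e))
  where
  lemma : ∀ σ a b c d → a + b + σ * (c + d) ≡ a + σ * c + (b + σ * d)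
  lemma = solve-∀

factor-· : ∀ σ e c f → factor σ e (c · f) ≗ c · factor σ e f
factor-· σ e c f m = lemma σ c (f m) (f (m - + e))
  where
  lemma : ∀ σ c a b → c * a + σ * (c * b) ≡ c * (a + σ * b)
  lemma = solve-∀

factor-shift : ∀ σ e d f → factor σ e (shift d f) ≗ shift d (factor σ e f)
factor-shift σ e d f m rewrite swap-exponents m (+ e) d = refl

factor-𝟘 : ∀ σ e → factor σ e 𝟘 ≗ 𝟘
factor-𝟘 σ e m = trans (ZP.+-identityˡ _) (ZP.*-zeroʳ σ)

prod-factor : ∀ fs σ e f → prod fs (factor σ e f) ≗ factor σ e (prod fs f)
prod-factor [] σ e f = ≗-refl
prod-factor ((τ , d) ∷ fs) σ e f =
  ≗-trans (factor-cong τ d (prod-factor fs σ e f)) (factor-comm τ d σ e (prod fs f))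

prod-prod : ∀ fs gs f → prod fs (prod gs f) ≗ prod gs (prod fs f)
prod-prod fs [] f = ≗-refl
prod-prod fs ((σ , e) ∷ gs) f =
  ≗-trans (prod-factor fs σ e (prod gs f)) (factor-cong σ e (prod-prod fs gs f))

prod-⊕ : ∀ fs f g → prod fs (f ⊕ g) ≗ prod fs f ⊕ prod fs g
prod-⊕ [] f g = ≗-refl
prod-⊕ ((σ , e) ∷ fs) f g =
  ≗-trans (factor-cong σ e (prod-⊕ fs f g)) (factor-⊕ σ e (prod fs f) (prod fs g))

prod-· : ∀ fs c f → prod fs (c · f) ≗ c · prod fs f
prod-· [] c f = ≗-refl
prod-· ((σ , e) ∷ fs) c f = ≗-trans (factor-cong σ e (prod-· fs c f)) (factor-· σ e c (prod fs f))

prod-shift : ∀ fs d f → prod fs (shift d f) ≗ shift d (prod fs f)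
prod-shift [] d f = ≗-refl
prod-shift ((σ , e) ∷ fs) d f =
  ≗-trans (factor-cong σ e (prod-shift fs d f)) (factor-shift σ e d (prod fs f))

prod-𝟘 : ∀ fs → prod fs 𝟘 ≗ 𝟘
prod-𝟘 [] = ≗-refl
prod-𝟘 ((σ , e) ∷ fs) = ≗-trans (factor-cong σ e (prod-𝟘 fs)) (factor-𝟘 σ e)

infix 4 _≡[_]_
_≡[_]_ : Series → ℤ → Series → Set
f ≡[ L ] g = ∀ m → m < L → f m ≡ g m

SupportedFrom : ℤ → Series → Set
SupportedFrom t f = ∀ m → m < t → f m ≡ + 0

≗⇒≡[] : ∀ {f g} L → f ≗ g → f ≡[ L ] g
≗⇒≡[] L p m _ = p m

≡[]-refl : ∀ {f L} → f ≡[ L ] f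
≡[]-refl m _ = refl

≡[]-sym : ∀ {f g L} → f ≡[ L ] g → g ≡[ L ] f
≡[]-sym p m lt = sym (p m lt)

≡[]-trans : ∀ {f g h L} → f ≡[ L ] g → g ≡[ L ] h → f ≡[ L ] h
≡[]-trans p q m lt = trans (p m lt) (q m lt)

≡[]-weaken : ∀ {f g L L′} → L′ ≤ L → f ≡[ L ] g → f ≡[ L′ ] g
≡[]-weaken le p m lt = p m (ZP.<-≤-trans lt le)

-- Lowering the exponent keeps it below any bound; this is why every operation below
-- (which only looks at lower exponents) respects truncated equality.
sub-< : ∀ m e L → m < L → m - + e < L
sub-< m e L lt = ZP.≤-<-trans (ZP.i-j≤i m (+ e)) lt

factor-≡[] : ∀ σ e {f g L} → f ≡[ L ] g → factor σ e f ≡[ L ] factor σ e g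
factor-≡[] σ e {L = L} p m lt = cong₂ (λ a b → a + σ * b) (p m lt) (p (m - + e) (sub-< m e L lt))

prod-≡[] : ∀ fs {f g L} → f ≡[ L ] g → prod fs f ≡[ L ] prod fs g
prod-≡[] [] p = p
prod-≡[] ((σ , e) ∷ fs) p = factor-≡[] σ e (prod-≡[] fs p)

shift-≡[] : ∀ u {f g L} → f ≡[ L - u ] g → shift u f ≡[ L ] shift u g
shift-≡[] u p m lt = p (m - u) (ZP.+-monoˡ-< (- u) lt)

shift-≡[]-nonneg : ∀ t {f g L} → + 0 ≤ t → f ≡[ L ] g → shift t f ≡[ L ] shift t g
shift-≡[]-nonneg t {L = L} 0≤t p = shift-≡[] t (λ m lt → p m (ZP.<-≤-trans lt L-t≤L))
  where
  L-t≤L : L - t ≤ L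
  L-t≤L = ZP.≤-trans (ZP.+-monoʳ-≤ L (ZP.neg-mono-≤ 0≤t)) (ZP.≤-reflexive (ZP.+-identityʳ L))

⊕-≡[] : ∀ {f f′ g g′ L} → f ≡[ L ] f′ → g ≡[ L ] g′ → f ⊕ g ≡[ L ] f′ ⊕ g′
⊕-≡[] p q m lt = cong₂ _+_ (p m lt) (q m lt)

·-≡[] : ∀ c {f g L} → f ≡[ L ] g → c · f ≡[ L ] c · g
·-≡[] c p m lt = cong (c *_) (p m lt)

supported⇒≡[] : ∀ {t f g L} → SupportedFrom t f → SupportedFrom t g → L ≤ t → f ≡[ L ] g
supported⇒≡[] sf sg le m lt = trans (sf m (ZP.<-≤-trans lt le)) (sym (sg m (ZP.<-≤-trans lt le)))

supported-weaken : ∀ {t t′ f} → t′ ≤ t → SupportedFrom t f → SupportedFrom t′ f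
supported-weaken le s m lt = s m (ZP.<-≤-trans lt le)

𝟘-supported : ∀ {t} → SupportedFrom t 𝟘
𝟘-supported m _ = refl

𝟙-supported : SupportedFrom (+ 0) 𝟙
𝟙-supported -[1+ _ ] _ = refl
𝟙-supported (+ n) (+<+ ())

shift-supported : ∀ d {t f} → SupportedFrom t f → SupportedFrom (t + d) (shift d f)
shift-supported d {t} s m lt = s (m - d) (subst (m - d <_) (lemma t d) (ZP.+-monoˡ-< (- d) lt))
  where
  lemma : ∀ t d → t + d - d ≡ t
  lemma = solve-∀

shift-supported₀ : ∀ e {f} → SupportedFrom (+ 0) f → SupportedFrom (+ 0) (shift (+ e) f)
shift-supported₀ e s = supported-weaken {t = + 0 + + e} (+≤+ z≤n) (shift-supported (+ e) s)

⊕-supported : ∀ {t f g} → SupportedFrom t f → SupportedFrom t g → SupportedFrom t (f ⊕ g)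
⊕-supported s r m lt rewrite s m lt | r m lt = refl

·-supported : ∀ c {t f} → SupportedFrom t f → SupportedFrom t (c · f)
·-supported c s m lt rewrite s m lt = ZP.*-zeroʳ c

factor-supported : ∀ σ e {t f} → SupportedFrom t f → SupportedFrom t (factor σ e f)
factor-supported σ e {t} s m lt rewrite s m lt | s (m - + e) (sub-< m e t lt) =
  trans (ZP.+-identityˡ _) (ZP.*-zeroʳ σ)

prod-supported : ∀ fs {t f} → SupportedFrom t f → SupportedFrom t (prod fs f)
prod-supported [] s = s
prod-supported ((σ , e) ∷ fs) s = factor-supported σ e (prod-supported fs s)

factor-≡[]-id : ∀ σ e {f L} → SupportedFrom (+ 0) f → L ≤ + e → factor σ e f ≡[ L ] f
factor-≡[]-id σ e {f} s le m lt =
  trans (cong (λ x → f m + σ * x) (s (m - + e) below))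
        (trans (cong (λ x → f m + x) (ZP.*-zeroʳ σ)) (ZP.+-identityʳ (f m)))
  where
  below : m - + e < + 0
  below = subst (m - + e <_) (ZP.+-inverseʳ (+ e)) (ZP.+-monoˡ-< (- + e) (ZP.<-≤-trans lt le))

-- A factor 1 + σ q^e with e ≥ 1 is invertible on series supported on ℕ, also modulo q^L:
-- the coefficient of q^m is recovered from those of (1 + σ q^e) f by induction on m.
factor-cancel : ∀ σ e {f g L} → SupportedFrom (+ 0) f → SupportedFrom (+ 0) g →
                factor σ (suc e) f ≡[ L ] factor σ (suc e) g → f ≡[ L ] g
factor-cancel σ e {f} {g} {L} sf sg h m = recover (suc ∣ m ∣) m (bound m)
  where
  bound : ∀ m → m < + suc ∣ m ∣
  bound (+ k) = +<+ (NP.n<1+n k)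
  bound -[1+ k ] = -<+
  unfactor : ∀ σ a b → a ≡ (a + σ * b) - σ * b
  unfactor = solve-∀
  recover : ∀ n m → m < + n → m < L → f m ≡ g m
  recover n -[1+ k ] _ _ = trans (sf _ -<+) (sym (sg _ -<+))
  recover (suc n) (+ k) (+<+ k<) lt =
    begin
      f (+ k)
    ≡⟨ unfactor σ (f (+ k)) (f k′) ⟩
      (f (+ k) + σ * f k′) - σ * f k′
    ≡⟨ cong₂ (λ a b → a - σ * b) (h (+ k) lt) (recover n k′ smaller (sub-< (+ k) (suc e) L lt)) ⟩
      (g (+ k) + σ * g k′) - σ * g k′
    ≡⟨ sym (unfactor σ (g (+ k)) (g k′)) ⟩
      g (+ k)
    ∎
    where
    open ≡-Reasoning
    k′ = + k - + suc e
    smaller : k′ < + n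
    smaller = ZP.<-≤-trans (ZP.m⊖1+n<m k (suc e)) (+≤+ (NP.≤-pred k<))

PositiveExponents : List Factor → Set
PositiveExponents = All (λ f → 1 N.≤ proj₂ f)

prod-cancel : ∀ fs {f g L} → PositiveExponents fs → SupportedFrom (+ 0) f → SupportedFrom (+ 0) g →
              prod fs f ≡[ L ] prod fs g → f ≡[ L ] g
prod-cancel [] [] sf sg h = h
prod-cancel ((σ , suc e) ∷ fs) (s≤s _ ∷ pos) sf sg h =
  prod-cancel fs pos sf sg (factor-cancel σ e (prod-supported fs sf) (prod-supported fs sg) h)

∑ : ℕ → (ℕ → Series) → Series
∑ zero g = 𝟘
∑ (suc n) g = g 0 ⊕ ∑ n (g ∘ suc)

∑-cong : ∀ n {g h} → (∀ i → i N.< n → g i ≗ h i) → ∑ n g ≗ ∑ n h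
∑-cong zero p = ≗-refl
∑-cong (suc n) p = ⊕-cong (p 0 (s≤s z≤n)) (∑-cong n (λ i lt → p (suc i) (s≤s lt)))

∑-≡[] : ∀ n {g h L} → (∀ i → i N.< n → g i ≡[ L ] h i) → ∑ n g ≡[ L ] ∑ n h
∑-≡[] zero p = ≡[]-refl
∑-≡[] (suc n) p = ⊕-≡[] (p 0 (s≤s z≤n)) (∑-≡[] n (λ i lt → p (suc i) (s≤s lt)))

prod-∑ : ∀ fs n g → prod fs (∑ n g) ≗ ∑ n (λ i → prod fs (g i))
prod-∑ fs zero g = prod-𝟘 fs
prod-∑ fs (suc n) g = ≗-trans (prod-⊕ fs (g 0) _) (⊕-congʳ (prod fs (g 0)) (prod-∑ fs n (g ∘ suc)))

shift-∑ : ∀ d n g → shift d (∑ n g) ≗ ∑ n (λ i → shift d (g i))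
shift-∑ d zero g = ≗-refl
shift-∑ d (suc n) g = ⊕-congʳ (shift d (g 0)) (shift-∑ d n (g ∘ suc))

·-∑ : ∀ c n g → c · ∑ n g ≗ ∑ n (λ i → c · g i)
·-∑ c zero g m = ZP.*-zeroʳ c
·-∑ c (suc n) g = ≗-trans (·-⊕ c (g 0) _) (⊕-congʳ (c · g 0) (·-∑ c n (g ∘ suc)))

private
  +-reassoc : ∀ a b c → a + (b + c) ≡ a + b + c
  +-reassoc = solve-∀

∑-snoc : ∀ n g → ∑ (suc n) g ≗ ∑ n g ⊕ g n
∑-snoc zero g m = trans (ZP.+-identityʳ (g 0 m)) (sym (ZP.+-identityˡ (g 0 m)))
∑-snoc (suc n) g m = trans (cong (λ z → g 0 m + z) (∑-snoc n (g ∘ suc) m)) (+-reassoc (g 0 m) _ _)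

∑-⊕ : ∀ n f g → ∑ n (λ i → f i ⊕ g i) ≗ ∑ n f ⊕ ∑ n g
∑-⊕ zero f g m = refl
∑-⊕ (suc n) f g m =
  trans (cong (λ z → f 0 m + g 0 m + z) (∑-⊕ n (f ∘ suc) (g ∘ suc) m))
        (lemma (f 0 m) (g 0 m) _ _)
  where
  lemma : ∀ a b c d → a + b + (c + d) ≡ a + c + (b + d)
  lemma = solve-∀

∑-split : ∀ k n g → ∑ (k N.+ n) g ≗ ∑ k g ⊕ ∑ n (λ t → g (k N.+ t))
∑-split zero n g m = sym (ZP.+-identityˡ _)
∑-split (suc k) n g m = trans (cong (λ z → g 0 m + z) (∑-split k n (g ∘ suc) m)) (+-reassoc (g 0 m) _ _)

∑-reverse : ∀ n g → ∑ n g ≗ ∑ n (λ t → g (n N.∸ suc t))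
∑-reverse zero g = ≗-refl
∑-reverse (suc n) g =
  begin
    g 0 ⊕ ∑ n (g ∘ suc)
  ≈⟨ ⊕-congʳ (g 0) (∑-reverse n (g ∘ suc)) ⟩
    g 0 ⊕ ∑ n (λ t → g (suc (n N.∸ suc t)))
  ≈⟨ ⊕-comm (g 0) _ ⟩
    ∑ n (λ t → g (suc (n N.∸ suc t))) ⊕ g 0
  ≈⟨ ⊕-congˡ (g 0) (∑-cong n (λ t lt m → cong (λ k → g k m) (sym (NP.+-∸-assoc 1 lt)))) ⟩
    ∑ n (λ t → g (suc n N.∸ suc t)) ⊕ g 0
  ≈⟨ ⊕-congʳ (∑ n (λ t → g (suc n N.∸ suc t))) (λ m → cong (λ k → g k m) (sym (NP.n∸n≡0 n))) ⟩
    ∑ n (λ t → g (suc n N.∸ suc t)) ⊕ g (suc n N.∸ suc n)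
  ≈⟨ ≗-sym (∑-snoc n (λ t → g (suc n N.∸ suc t))) ⟩
    ∑ (suc n) (λ t → g (suc n N.∸ suc t))
  ∎
  where open ≗-Reasoning

∑-centre : ∀ X F → ∑ (suc (X N.+ X)) F ≗ F X ⊕ ∑ X (λ t → F (X N.+ suc t) ⊕ F (X N.∸ suc t))
∑-centre X F =
  begin
    ∑ (suc (X N.+ X)) F
  ≈⟨ (λ m → cong (λ k → ∑ k F m) (sym (NP.+-suc X X))) ⟩
    ∑ (X N.+ suc X) F
  ≈⟨ ∑-split X (suc X) F ⟩
    ∑ X F ⊕ (F (X N.+ 0) ⊕ ∑ X (λ t → F (X N.+ suc t)))
  ≈⟨ ⊕-cong (∑-reverse X F) (⊕-congˡ (∑ X (λ t → F (X N.+ suc t))) (λ m → cong (λ k → F k m) (NP.+-identityʳ X))) ⟩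
    ∑ X (λ t → F (X N.∸ suc t)) ⊕ (F X ⊕ ∑ X (λ t → F (X N.+ suc t)))
  ≈⟨ (λ m → rotate (∑ X (λ t → F (X N.∸ suc t)) m) (F X m) (∑ X (λ t → F (X N.+ suc t)) m)) ⟩
    F X ⊕ (∑ X (λ t → F (X N.+ suc t)) ⊕ ∑ X (λ t → F (X N.∸ suc t)))
  ≈⟨ ⊕-congʳ (F X) (≗-sym (∑-⊕ X (λ t → F (X N.+ suc t)) (λ t → F (X N.∸ suc t)))) ⟩
    F X ⊕ ∑ X (λ t → F (X N.+ suc t) ⊕ F (X N.∸ suc t))
  ∎
  where
  open ≗-Reasoning
  rotate : ∀ a b c → a + (b + c) ≡ b + (c + a)
  rotate = solve-∀

∑-pairs : ∀ X g → ∑ (X N.+ X) g ≗ ∑ X (λ t → g (t N.+ t) ⊕ g (suc (t N.+ t)))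
∑-pairs zero g = ≗-refl
∑-pairs (suc X) g m =
  trans (cong (λ k → g 0 m + ∑ k (g ∘ suc) m) (NP.+-suc X X))
    (trans (cong (λ z → g 0 m + (g 1 m + z)) (∑-pairs X (g ∘ suc ∘ suc) m))
      (trans (+-reassoc (g 0 m) (g 1 m) _)
        (cong (λ z → g 0 m + g 1 m + z)
          (∑-cong X (λ t _ m′ → cong₂ (λ a b → g a m′ + g b m′) (sym (double t)) (sym (cong suc (double t)))) m))))
  where
  double : ∀ t → suc t N.+ suc t ≡ suc (suc (t N.+ t))
  double t = cong suc (NP.+-suc t t)

-- Polynomials in an auxiliary variable x with series coefficients: the i-th entry of the
-- list is the coefficient of x^i.
XPoly : Set
XPoly = List Series

infixl 6 _⊞_
_⊞_ : XPoly → XPoly → XPoly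
[] ⊞ ys = ys
(x ∷ xs) ⊞ [] = x ∷ xs
(x ∷ xs) ⊞ (y ∷ ys) = (x ⊕ y) ∷ (xs ⊞ ys)

shiftPoly : ℕ → XPoly → XPoly
shiftPoly e = map (shift (+ e))

-- (1 + x q^e) · P  and  (x + q^e) · P
mulZ mulW : ℕ → XPoly → XPoly
mulZ e P = P ⊞ (𝟘 ∷ shiftPoly e P)
mulW e P = (𝟘 ∷ P) ⊞ shiftPoly e P

coef : ℕ → XPoly → Series
coef i [] = 𝟘
coef zero (x ∷ xs) = x
coef (suc i) (x ∷ xs) = coef i xs

prev : ℕ → XPoly → Series
prev zero P = 𝟘
prev (suc i) P = coef i P

coef-⊞ : ∀ i xs ys → coef i (xs ⊞ ys) ≗ coef i xs ⊕ coef i ys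
coef-⊞ i [] ys = ≗-sym (⊕-identityˡ (coef i ys))
coef-⊞ zero (x ∷ xs) [] = ≗-sym (⊕-identityʳ x)
coef-⊞ (suc i) (x ∷ xs) [] = ≗-sym (⊕-identityʳ (coef i xs))
coef-⊞ zero (x ∷ xs) (y ∷ ys) = ≗-refl
coef-⊞ (suc i) (x ∷ xs) (y ∷ ys) = coef-⊞ i xs ys

coef-shiftPoly : ∀ i e P → coef i (shiftPoly e P) ≗ shift (+ e) (coef i P)
coef-shiftPoly i e [] = ≗-refl
coef-shiftPoly zero e (x ∷ P) = ≗-refl
coef-shiftPoly (suc i) e (x ∷ P) = coef-shiftPoly i e P

coef-mulZ : ∀ i e P → coef i (mulZ e P) ≗ coef i P ⊕ shift (+ e) (prev i P)
coef-mulZ zero e P = coef-⊞ zero P (𝟘 ∷ shiftPoly e P)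
coef-mulZ (suc i) e P =
  ≗-trans (coef-⊞ (suc i) P (𝟘 ∷ shiftPoly e P)) (⊕-congʳ (coef (suc i) P) (coef-shiftPoly i e P))

coef-mulW : ∀ i e P → coef i (mulW e P) ≗ prev i P ⊕ shift (+ e) (coef i P)
coef-mulW zero e P =
  ≗-trans (coef-⊞ zero (𝟘 ∷ P) (shiftPoly e P)) (⊕-congʳ 𝟘 (coef-shiftPoly zero e P))
coef-mulW (suc i) e P =
  ≗-trans (coef-⊞ (suc i) (𝟘 ∷ P) (shiftPoly e P)) (⊕-congʳ (coef i P) (coef-shiftPoly (suc i) e P))

coef-beyond : ∀ i P → length P N.≤ i → coef i P ≗ 𝟘
coef-beyond i [] _ = ≗-refl
coef-beyond (suc i) (x ∷ P) (s≤s le) = coef-beyond i P le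

length-⊞ : ∀ xs ys → length (xs ⊞ ys) ≡ length xs N.⊔ length ys
length-⊞ [] ys = refl
length-⊞ (x ∷ xs) [] = sym (NP.⊔-identityʳ (suc (length xs)))
length-⊞ (x ∷ xs) (y ∷ ys) = cong suc (length-⊞ xs ys)

length-mulZ : ∀ e P → length (mulZ e P) ≡ suc (length P)
length-mulZ e P =
  trans (length-⊞ P (𝟘 ∷ shiftPoly e P))
    (trans (cong (λ n → length P N.⊔ suc n) (LP.length-map (shift (+ e)) P))
      (NP.m≤n⇒m⊔n≡n (NP.n≤1+n (length P))))

length-mulW : ∀ e P → length (mulW e P) ≡ suc (length P)
length-mulW e P =
  trans (length-⊞ (𝟘 ∷ P) (shiftPoly e P))
    (trans (cong (λ n → suc (length P) N.⊔ n) (LP.length-map (shift (+ e)) P))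
      (NP.m≥n⇒m⊔n≡m (NP.n≤1+n (length P))))

CoeffsSupported : XPoly → Set
CoeffsSupported P = ∀ i → SupportedFrom (+ 0) (coef i P)

prev-supported : ∀ {P} → CoeffsSupported P → ∀ i → SupportedFrom (+ 0) (prev i P)
prev-supported s zero = 𝟘-supported
prev-supported s (suc i) = s i

mulZ-supported : ∀ e {P} → CoeffsSupported P → CoeffsSupported (mulZ e P)
mulZ-supported e {P} s i m lt =
  trans (coef-mulZ i e P m) (⊕-supported (s i) (shift-supported₀ e (prev-supported s i)) m lt)

mulW-supported : ∀ e {P} → CoeffsSupported P → CoeffsSupported (mulW e P)
mulW-supported e {P} s i m lt =
  trans (coef-mulW i e P m) (⊕-supported (prev-supported s i) (shift-supported₀ e (s i)) m lt)

-- Triangular numbers T(n) = n(n+1)/2, and their extension T(j) = j(j+1)/2 to j ∈ ℤ, which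
-- is again a natural number (T(-n-1) = T(n)).
tri : ℕ → ℕ
tri zero = zero
tri (suc n) = tri n N.+ suc n

triℤ : ℤ → ℕ
triℤ (+ n) = tri n
triℤ -[1+ n ] = tri n

triℤ-step : ∀ j → + triℤ (j - + 1) + j ≡ + triℤ j
triℤ-step (+ zero) = refl
triℤ-step (+ suc n) = refl
triℤ-step -[1+ n ] rewrite NP.+-identityʳ n = lemma (+ tri n) (+ suc n)
  where
  lemma : ∀ t s → t + s + - s ≡ t
  lemma = solve-∀

double-tri : ∀ t → 2 N.* tri t ≡ t N.* suc t
double-tri zero = refl
double-tri (suc t) =
  trans (distrib (tri t) t) (trans (cong (N._+ 2 N.* suc t) (double-tri t)) (collect t))
  where
  distrib : ∀ a t → 2 N.* (a N.+ suc t) ≡ 2 N.* a N.+ 2 N.* suc t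
  distrib = NatSolver.solve-∀
  collect : ∀ t → t N.* suc t N.+ 2 N.* suc t ≡ suc t N.* suc (suc t)
  collect = NatSolver.solve-∀

-- The finite q-binomial theorem, for the base q^c.  Writing (a)_r = (q^c;q^c)_r, the
-- polynomial P = ∏_{n=1}^{N} (1 + x q^{cn}) ∏_{k=0}^{K-1} (x + q^{ck}) of degree M = N + K
-- satisfies the coefficient law
--   (a)_i (a)_r [x^i] P = q^{c T(i-K)} (a)_M     for i + r = M.
module CoefficientLaw (c : ℕ) where

  pochFactors : ℕ → List Factor
  pochFactors zero = []
  pochFactors (suc r) = (-[1+ 0 ] , c N.* suc r) ∷ pochFactors r

  poch : ℕ → Series → Series
  poch r = prod (pochFactors r)

  poch₂ : ℕ → ℕ → Series → Series
  poch₂ r i f = poch r (poch i f)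

  c*T : ℤ → ℤ
  c*T j = + c * + triℤ j

  c*T-nonneg : ∀ j → + 0 ≤ c*T j
  c*T-nonneg j = subst (+ 0 ≤_) (ZP.pos-* c (triℤ j)) (+≤+ z≤n)

  Law : XPoly → ℕ → ℕ → Set
  Law P M K = ∀ i r → i N.+ r ≡ M → poch₂ r i (coef i P) ≗ shift (c*T (+ i - + K)) (poch M 𝟙)

  poch₂-⊕ : ∀ r i f g → poch₂ r i (f ⊕ g) ≗ poch₂ r i f ⊕ poch₂ r i g
  poch₂-⊕ r i f g = ≗-trans (prod-cong (pochFactors r) (prod-⊕ (pochFactors i) f g)) (prod-⊕ (pochFactors r) _ _)

  poch₂-shift : ∀ r i e f → poch₂ r i (shift e f) ≗ shift e (poch₂ r i f)
  poch₂-shift r i e f =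
    ≗-trans (prod-cong (pochFactors r) (prod-shift (pochFactors i) e f)) (prod-shift (pochFactors r) e _)

  poch₂-𝟘 : ∀ r i → poch₂ r i 𝟘 ≗ 𝟘
  poch₂-𝟘 r i = ≗-trans (prod-cong (pochFactors r) (prod-𝟘 (pochFactors i))) (prod-𝟘 (pochFactors r))

  poch₂-suc : ∀ r i f → poch₂ r (suc i) f ≗ factor -[1+ 0 ] (c N.* suc i) (poch₂ r i f)
  poch₂-suc r i f = prod-factor (pochFactors r) -[1+ 0 ] (c N.* suc i) (poch i f)

  -- (1 - q^x) + q^x (1 - q^y) = 1 - q^{x+y}: the Pascal step for the (q^c;q^c) symbols.
  telescope : ∀ t u x y G → u ≡ t + + x →
              shift t (factor -[1+ 0 ] x G) ⊕ shift u (factor -[1+ 0 ] y G) ≗ shift t (factor -[1+ 0 ] (x N.+ y) G)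
  telescope t .(t + + x) x y G refl m =
    trans (cong₂ (λ a b → G (m - t) + -[1+ 0 ] * G (m - t - + x) + (G a + -[1+ 0 ] * G b))
                 (split₁ m t (+ x)) (split₂ m t (+ x) (+ y)))
          (cancel (G (m - t)) (G (m - t - + x)) (G (m - t - (+ x + + y))))
    where
    split₁ : ∀ m t x → m - (t + x) ≡ m - t - x
    split₁ = solve-∀
    split₂ : ∀ m t x y → m - (t + x) - y ≡ m - t - (x + y)
    split₂ = solve-∀
    cancel : ∀ a b c → a + -[1+ 0 ] * b + (b + -[1+ 0 ] * c) ≡ a + -[1+ 0 ] * c
    cancel = solve-∀

  -- Exponent bookkeeping; everything follows from T(j + 1) = T(j) + (j + 1).
  private
    tri-up : ∀ j → c*T (j + + 1) ≡ c*T j + + c * (j + + 1)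
    tri-up j =
      trans (cong (λ z → + c * z) (sym (triℤ-step (j + + 1))))
        (trans (cong (λ z → + c * (+ triℤ z + (j + + 1))) (lemma j))
          (ZP.*-distribˡ-+ (+ c) (+ triℤ j) (j + + 1)))
      where
      lemma : ∀ j → j + + 1 - + 1 ≡ j
      lemma = solve-∀

    arg-suc : ∀ i K → + suc i - + K ≡ (+ i - + K) + + 1
    arg-suc i K = lemma (+ i) (+ K)
      where
      lemma : ∀ i K → + 1 + i - K ≡ i - K + + 1
      lemma = solve-∀

    arg-suc-suc : ∀ i K → + suc i - + suc K ≡ + i - + K
    arg-suc-suc i K = lemma (+ i) (+ K)
      where
      lemma : ∀ i K → + 1 + i - (+ 1 + K) ≡ i - K
      lemma = solve-∀

    exp-W₀ : ∀ K → + (c N.* K) + c*T (+ 0 - + K) ≡ c*T (+ 0 - + suc K)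
    exp-W₀ K =
      begin
        + (c N.* K) + c*T (+ 0 - + K)
      ≡⟨ cong₂ _+_ (ZP.pos-* c K) (cong c*T (arg K)) ⟩
        + c * + K + c*T (j + + 1)
      ≡⟨ cong (λ z → + c * + K + z) (tri-up j) ⟩
        + c * + K + (c*T j + + c * (j + + 1))
      ≡⟨ lemma (+ c) (+ K) (+ triℤ j) ⟩
        c*T j
      ∎
      where
      open ≡-Reasoning
      j = + 0 - + suc K
      arg : ∀ K → + 0 - + K ≡ (+ 0 - + suc K) + + 1
      arg K = argℤ (+ K)
        where
        argℤ : ∀ K → + 0 - K ≡ (+ 0 - (+ 1 + K)) + + 1
        argℤ = solve-∀
      lemma : ∀ c K t → c * K + (c * t + c * ((+ 0 - (+ 1 + K)) + + 1)) ≡ c * t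
      lemma = solve-∀

    exp-W₁ : ∀ K i → + (c N.* K) + c*T (+ suc i - + K) ≡ c*T (+ i - + K) + + (c N.* suc i)
    exp-W₁ K i =
      begin
        + (c N.* K) + c*T (+ suc i - + K)
      ≡⟨ cong₂ _+_ (ZP.pos-* c K) (trans (cong c*T (arg-suc i K)) (tri-up j)) ⟩
        + c * + K + (c*T j + + c * (j + + 1))
      ≡⟨ lemma (+ c) (+ K) (+ i) (+ triℤ j) ⟩
        c*T j + + c * + suc i
      ≡⟨ cong (λ z → c*T j + z) (sym (ZP.pos-* c (suc i))) ⟩
        c*T j + + (c N.* suc i)
      ∎
      where
      open ≡-Reasoning
      j = + i - + K
      lemma : ∀ c K i t → c * K + (c * t + c * ((i - K) + + 1)) ≡ c * t + c * (+ 1 + i)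
      lemma = solve-∀

    -- c (N+1) + c T(N) = c T(N+1), written with N = (N + K) - K
    exp-Z₀ : ∀ N K → + (c N.* suc N) + c*T (+ (N N.+ K) - + K) ≡ c*T (+ suc (N N.+ K) - + K)
    exp-Z₀ N K =
      begin
        + (c N.* suc N) + c*T j
      ≡⟨ cong (λ z → z + c*T j) (ZP.pos-* c (suc N)) ⟩
        + c * + suc N + c*T j
      ≡⟨ lemma (+ c) (+ N) (+ K) (+ triℤ j) ⟩
        c*T j + + c * (j + + 1)
      ≡⟨ sym (trans (cong c*T (arg-suc (N N.+ K) K)) (tri-up j)) ⟩
        c*T (+ suc (N N.+ K) - + K)
      ∎
      where
      open ≡-Reasoning
      j = + (N N.+ K) - + K
      lemma : ∀ c N K t → c * (+ 1 + N) + c * t ≡ c * t + c * ((N + K) - K + + 1)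
      lemma = solve-∀

    exp-Z₁ : ∀ N K i r → i N.+ suc r ≡ N N.+ K →
             + (c N.* suc N) + c*T (+ i - + K) ≡ c*T (+ suc i - + K) + + (c N.* suc r)
    exp-Z₁ N K i r h =
      begin
        + (c N.* suc N) + c*T j
      ≡⟨ cong (λ z → z + c*T j) (trans (ZP.pos-* c (suc N)) (cong (λ z → + c * z) (degree (+ N) (+ K)))) ⟩
        + c * (+ 1 + + (N N.+ K) - + K) + c*T j
      ≡⟨ cong (λ n → + c * (+ 1 + + n - + K) + c*T j) (sym h) ⟩
        + c * (+ 1 + + (i N.+ suc r) - + K) + c*T j
      ≡⟨ lemma (+ c) (+ i) (+ r) (+ K) (+ triℤ j) ⟩
        (c*T j + + c * (j + + 1)) + + c * + suc r
      ≡⟨ cong₂ _+_ (sym (trans (cong c*T (arg-suc i K)) (tri-up j))) (sym (ZP.pos-* c (suc r))) ⟩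
        c*T (+ suc i - + K) + + (c N.* suc r)
      ∎
      where
      open ≡-Reasoning
      j = + i - + K
      degree : ∀ N K → + 1 + N ≡ + 1 + (N + K) - K
      degree = solve-∀
      lemma : ∀ c i r K t → c * (+ 1 + (i + (+ 1 + r)) - K) + c * t ≡ (c * t + c * ((i - K) + + 1)) + c * (+ 1 + r)
      lemma = solve-∀

  law-base : Law (𝟙 ∷ []) 0 0
  law-base zero zero refl = ≗-sym (≗-trans (shift-≡ 𝟙 (ZP.*-zeroʳ (+ c))) (shift-zero 𝟙))

  law-mulW : ∀ P M K → length P ≡ suc M → Law P M K → Law (mulW (c N.* K) P) (suc M) (suc K)
  law-mulW P M K len law zero .(suc M) refl =
    begin
      poch (suc M) (coef 0 (mulW e P))
    ≈⟨ prod-cong (pochFactors (suc M)) (≗-trans (coef-mulW 0 e P) (⊕-identityˡ _)) ⟩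
      poch (suc M) (shift (+ e) (coef 0 P))
    ≈⟨ prod-shift (pochFactors (suc M)) (+ e) (coef 0 P) ⟩
      shift (+ e) (factor -[1+ 0 ] (c N.* suc M) (poch M (coef 0 P)))
    ≈⟨ shift-cong (+ e) (factor-cong -[1+ 0 ] (c N.* suc M) (law 0 M refl)) ⟩
      shift (+ e) (factor -[1+ 0 ] (c N.* suc M) (shift t₀ (poch M 𝟙)))
    ≈⟨ shift-cong (+ e) (factor-shift -[1+ 0 ] (c N.* suc M) t₀ (poch M 𝟙)) ⟩
      shift (+ e) (shift t₀ (poch (suc M) 𝟙))
    ≈⟨ shift-shift (+ e) t₀ (poch (suc M) 𝟙) ⟩
      shift (+ e + t₀) (poch (suc M) 𝟙)
    ≈⟨ shift-≡ (poch (suc M) 𝟙) (exp-W₀ K) ⟩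
      shift (c*T (+ 0 - + suc K)) (poch (suc M) 𝟙)
    ∎
    where
    open ≗-Reasoning
    e = c N.* K
    t₀ = c*T (+ 0 - + K)
  law-mulW P M K len law (suc i) zero eq with trans (sym (NP.+-identityʳ (suc i))) eq
  ... | refl =
    begin
      poch (suc M) (coef (suc M) (mulW e P))
    ≈⟨ prod-cong (pochFactors (suc M)) top ⟩
      poch (suc M) (coef M P)
    ≈⟨ factor-cong -[1+ 0 ] (c N.* suc M) (law M 0 (NP.+-identityʳ M)) ⟩
      factor -[1+ 0 ] (c N.* suc M) (shift t₁ (poch M 𝟙))
    ≈⟨ factor-shift -[1+ 0 ] (c N.* suc M) t₁ (poch M 𝟙) ⟩
      shift t₁ (poch (suc M) 𝟙)
    ≈⟨ shift-≡ (poch (suc M) 𝟙) (cong c*T (sym (arg-suc-suc M K))) ⟩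
      shift (c*T (+ suc M - + suc K)) (poch (suc M) 𝟙)
    ∎
    where
    open ≗-Reasoning
    e = c N.* K
    t₁ = c*T (+ M - + K)
    top : coef (suc M) (mulW e P) ≗ coef M P
    top = ≗-trans (coef-mulW (suc M) e P)
            (≗-trans (⊕-congʳ (coef M P) (shift-cong (+ e) (coef-beyond (suc M) P (NP.≤-reflexive len))))
              (⊕-identityʳ (coef M P)))
  law-mulW P M K len law (suc i) (suc r) eq =
    begin
      poch₂ (suc r) (suc i) (coef (suc i) (mulW e P))
    ≈⟨ prod-cong (pochFactors (suc r)) (prod-cong (pochFactors (suc i)) (coef-mulW (suc i) e P)) ⟩
      poch₂ (suc r) (suc i) (coef i P ⊕ shift (+ e) (coef (suc i) P))
    ≈⟨ poch₂-⊕ (suc r) (suc i) _ _ ⟩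
      poch₂ (suc r) (suc i) (coef i P) ⊕ poch₂ (suc r) (suc i) (shift (+ e) (coef (suc i) P))
    ≈⟨ ⊕-cong lower upper ⟩
      shift t₁ (factor -[1+ 0 ] x (poch M 𝟙)) ⊕ shift (+ e + t₂) (factor -[1+ 0 ] y (poch M 𝟙))
    ≈⟨ telescope t₁ (+ e + t₂) x y (poch M 𝟙) (exp-W₁ K i) ⟩
      shift t₁ (factor -[1+ 0 ] (x N.+ y) (poch M 𝟙))
    ≈⟨ shift-cong t₁ (factor-≡ -[1+ 0 ] (poch M 𝟙) x+y) ⟩
      shift t₁ (poch (suc M) 𝟙)
    ≈⟨ shift-≡ (poch (suc M) 𝟙) (cong c*T (sym (arg-suc-suc i K))) ⟩
      shift (c*T (+ suc i - + suc K)) (poch (suc M) 𝟙)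
    ∎
    where
    open ≗-Reasoning
    e = c N.* K
    x = c N.* suc i
    y = c N.* suc r
    t₁ = c*T (+ i - + K)
    t₂ = c*T (+ suc i - + K)
    eq₁ : i N.+ suc r ≡ M
    eq₁ = NP.suc-injective eq
    x+y : x N.+ y ≡ c N.* suc M
    x+y = trans (sym (NP.*-distribˡ-+ c (suc i) (suc r))) (cong (λ k → c N.* suc k) eq₁)
    lower : poch₂ (suc r) (suc i) (coef i P) ≗ shift t₁ (factor -[1+ 0 ] x (poch M 𝟙))
    lower = ≗-trans (poch₂-suc (suc r) i (coef i P))
              (≗-trans (factor-cong -[1+ 0 ] x (law i (suc r) eq₁)) (factor-shift -[1+ 0 ] x t₁ (poch M 𝟙)))
    upper : poch₂ (suc r) (suc i) (shift (+ e) (coef (suc i) P)) ≗ shift (+ e + t₂) (factor -[1+ 0 ] y (poch M 𝟙))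
    upper = ≗-trans (poch₂-shift (suc r) (suc i) (+ e) _)
              (≗-trans (shift-cong (+ e) (factor-cong -[1+ 0 ] y (law (suc i) r (trans (sym (NP.+-suc i r)) eq₁))))
                (≗-trans (shift-cong (+ e) (factor-shift -[1+ 0 ] y t₂ (poch M 𝟙)))
                  (shift-shift (+ e) t₂ (factor -[1+ 0 ] y (poch M 𝟙)))))

  law-mulZ : ∀ P N K → length P ≡ suc (N N.+ K) → Law P (N N.+ K) K →
             Law (mulZ (c N.* suc N) P) (suc N N.+ K) K
  law-mulZ P N K len law zero .(suc (N N.+ K)) refl =
    begin
      poch (suc M) (coef 0 (mulZ e P))
    ≈⟨ prod-cong (pochFactors (suc M)) (≗-trans (coef-mulZ 0 e P) (⊕-identityʳ (coef 0 P))) ⟩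
      factor -[1+ 0 ] (c N.* suc M) (poch M (coef 0 P))
    ≈⟨ factor-cong -[1+ 0 ] (c N.* suc M) (law 0 M refl) ⟩
      factor -[1+ 0 ] (c N.* suc M) (shift t₀ (poch M 𝟙))
    ≈⟨ factor-shift -[1+ 0 ] (c N.* suc M) t₀ (poch M 𝟙) ⟩
      shift t₀ (poch (suc M) 𝟙)
    ∎
    where
    open ≗-Reasoning
    M = N N.+ K
    e = c N.* suc N
    t₀ = c*T (+ 0 - + K)
  law-mulZ P N K len law (suc i) zero eq with trans (sym (NP.+-identityʳ (suc i))) eq
  ... | refl =
    begin
      poch (suc M) (coef (suc M) (mulZ e P))
    ≈⟨ prod-cong (pochFactors (suc M)) top ⟩
      poch (suc M) (shift (+ e) (coef M P))
    ≈⟨ prod-shift (pochFactors (suc M)) (+ e) (coef M P) ⟩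
      shift (+ e) (factor -[1+ 0 ] (c N.* suc M) (poch M (coef M P)))
    ≈⟨ shift-cong (+ e) (factor-cong -[1+ 0 ] (c N.* suc M) (law M 0 (NP.+-identityʳ M))) ⟩
      shift (+ e) (factor -[1+ 0 ] (c N.* suc M) (shift t₁ (poch M 𝟙)))
    ≈⟨ shift-cong (+ e) (factor-shift -[1+ 0 ] (c N.* suc M) t₁ (poch M 𝟙)) ⟩
      shift (+ e) (shift t₁ (poch (suc M) 𝟙))
    ≈⟨ shift-shift (+ e) t₁ (poch (suc M) 𝟙) ⟩
      shift (+ e + t₁) (poch (suc M) 𝟙)
    ≈⟨ shift-≡ (poch (suc M) 𝟙) (exp-Z₀ N K) ⟩
      shift (c*T (+ suc M - + K)) (poch (suc M) 𝟙)
    ∎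
    where
    open ≗-Reasoning
    M = N N.+ K
    e = c N.* suc N
    t₁ = c*T (+ M - + K)
    top : coef (suc M) (mulZ e P) ≗ shift (+ e) (coef M P)
    top = ≗-trans (coef-mulZ (suc M) e P)
            (≗-trans (⊕-congˡ (shift (+ e) (coef M P)) (coef-beyond (suc M) P (NP.≤-reflexive len)))
              (⊕-identityˡ (shift (+ e) (coef M P))))
  law-mulZ P N K len law (suc i) (suc r) eq =
    begin
      poch₂ (suc r) (suc i) (coef (suc i) (mulZ e P))
    ≈⟨ prod-cong (pochFactors (suc r)) (prod-cong (pochFactors (suc i)) (coef-mulZ (suc i) e P)) ⟩
      poch₂ (suc r) (suc i) (coef (suc i) P ⊕ shift (+ e) (coef i P))
    ≈⟨ poch₂-⊕ (suc r) (suc i) _ _ ⟩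
      poch₂ (suc r) (suc i) (coef (suc i) P) ⊕ poch₂ (suc r) (suc i) (shift (+ e) (coef i P))
    ≈⟨ ⊕-cong lower upper ⟩
      shift t₂ (factor -[1+ 0 ] y (poch M 𝟙)) ⊕ shift (+ e + t₁) (factor -[1+ 0 ] x (poch M 𝟙))
    ≈⟨ telescope t₂ (+ e + t₁) y x (poch M 𝟙) (exp-Z₁ N K i r eq₁) ⟩
      shift t₂ (factor -[1+ 0 ] (y N.+ x) (poch M 𝟙))
    ≈⟨ shift-cong t₂ (factor-≡ -[1+ 0 ] (poch M 𝟙) y+x) ⟩
      shift t₂ (poch (suc M) 𝟙)
    ∎
    where
    open ≗-Reasoning
    M = N N.+ K
    e = c N.* suc N
    x = c N.* suc i
    y = c N.* suc r
    t₁ = c*T (+ i - + K)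
    t₂ = c*T (+ suc i - + K)
    eq₁ : i N.+ suc r ≡ M
    eq₁ = NP.suc-injective eq
    y+x : y N.+ x ≡ c N.* suc M
    y+x = trans (NP.+-comm y x)
            (trans (sym (NP.*-distribˡ-+ c (suc i) (suc r))) (cong (λ k → c N.* suc k) eq₁))
    lower : poch₂ (suc r) (suc i) (coef (suc i) P) ≗ shift t₂ (factor -[1+ 0 ] y (poch M 𝟙))
    lower = ≗-trans (factor-cong -[1+ 0 ] y (law (suc i) r (trans (sym (NP.+-suc i r)) eq₁)))
              (factor-shift -[1+ 0 ] y t₂ (poch M 𝟙))
    upper : poch₂ (suc r) (suc i) (shift (+ e) (coef i P)) ≗ shift (+ e + t₁) (factor -[1+ 0 ] x (poch M 𝟙))
    upper = ≗-trans (poch₂-shift (suc r) (suc i) (+ e) _)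
              (≗-trans (shift-cong (+ e) (poch₂-suc (suc r) i (coef i P)))
                (≗-trans (shift-cong (+ e) (factor-cong -[1+ 0 ] x (law i (suc r) eq₁)))
                  (≗-trans (shift-cong (+ e) (factor-shift -[1+ 0 ] x t₁ (poch M 𝟙)))
                    (shift-shift (+ e) t₁ (factor -[1+ 0 ] x (poch M 𝟙))))))

  PW : ℕ → XPoly
  PW zero = 𝟙 ∷ []
  PW (suc K) = mulW (c N.* K) (PW K)

  PZ : ℕ → ℕ → XPoly
  PZ zero K = PW K
  PZ (suc N) K = mulZ (c N.* suc N) (PZ N K)

  length-PW : ∀ K → length (PW K) ≡ suc K
  length-PW zero = refl
  length-PW (suc K) = trans (length-mulW (c N.* K) (PW K)) (cong suc (length-PW K))

  length-PZ : ∀ N K → length (PZ N K) ≡ suc (N N.+ K)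
  length-PZ zero K = length-PW K
  length-PZ (suc N) K = trans (length-mulZ (c N.* suc N) (PZ N K)) (cong suc (length-PZ N K))

  law-PW : ∀ K → Law (PW K) K K
  law-PW zero = law-base
  law-PW (suc K) = law-mulW (PW K) K K (length-PW K) (law-PW K)

  law-PZ : ∀ N K → Law (PZ N K) (N N.+ K) K
  law-PZ zero K = law-PW K
  law-PZ (suc N) K = law-mulZ (PZ N K) N K (length-PZ N K) (law-PZ N K)

  PZ-supported : ∀ N K → CoeffsSupported (PZ N K)
  PZ-supported zero zero zero = 𝟙-supported
  PZ-supported zero zero (suc i) = 𝟘-supported
  PZ-supported zero (suc K) = mulW-supported (c N.* K) {PW K} (PZ-supported zero K)
  PZ-supported (suc N) K = mulZ-supported (c N.* suc N) {PZ N K} (PZ-supported N K)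

-- Substituting x = ε q^a into an x-polynomial (ε a sign, a ∈ ℤ), and normalising by the
-- factor (ε q^a)^{-K}.  Under this substitution the factors (1 + x q^e) and (x + q^e)
-- become the binomials (1 + ε q^{e+a}) and (1 + ε q^{e-a}) (the latter after dividing by x).
module Substitution (ε a : ℤ) where


  subst-x : XPoly → Series
  subst-x [] = 𝟘
  subst-x (p ∷ P) = p ⊕ ε · shift a (subst-x P)

  subst-x-⊞ : ∀ P Q → subst-x (P ⊞ Q) ≗ subst-x P ⊕ subst-x Q
  subst-x-⊞ [] Q m = sym (ZP.+-identityˡ _)
  subst-x-⊞ (p ∷ P) [] m = sym (ZP.+-identityʳ _)
  subst-x-⊞ (p ∷ P) (q ∷ Q) m rewrite subst-x-⊞ P Q (m - a) =
    lemma (p m) (q m) (subst-x P (m - a)) (subst-x Q (m - a)) ε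
    where
    lemma : ∀ p q r s e → p + q + e * (r + s) ≡ p + e * r + (q + e * s)
    lemma = solve-∀

  subst-x-shiftPoly : ∀ e P → subst-x (shiftPoly e P) ≗ shift (+ e) (subst-x P)
  subst-x-shiftPoly e [] m = refl
  subst-x-shiftPoly e (p ∷ P) m rewrite subst-x-shiftPoly e P (m - a) | swap-exponents m a (+ e) = refl

  subst-x-∑ : ∀ P → subst-x P ≗ ∑ (length P) (λ i → (ε ^ i) · shift (a * + i) (coef i P))
  subst-x-∑ [] = ≗-refl
  subst-x-∑ (p ∷ P) =
    ⊕-cong constant
      (≗-trans (·-cong ε (shift-cong a (subst-x-∑ P)))
        (≗-trans (·-cong ε (shift-∑ a (length P) _))
          (≗-trans (·-∑ ε (length P) _) (∑-cong (length P) (λ i _ m → step i m)))))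
    where
    constant : p ≗ (ε ^ 0) · shift (a * + 0) p
    constant m = sym (trans (ZP.*-identityˡ _) (cong p (trans (cong (λ z → m - z) (ZP.*-zeroʳ a)) (ZP.+-identityʳ m))))
    argument : ∀ m a i → m - a - a * i ≡ m - a * (+ 1 + i)
    argument = solve-∀
    step : ∀ i m → ε * (ε ^ i * coef i P (m - a - a * + i)) ≡ ε * ε ^ i * coef i P (m - a * + suc i)
    step i m rewrite argument m a (+ i) = sym (ZP.*-assoc ε (ε ^ i) _)

  normalise : ℕ → Series → Series
  normalise K f = (ε ^ K) · shift (- (a * + K)) f

  normalise-mulZ : ∀ K e e′ P → + e′ ≡ + e + a →
                   normalise K (subst-x (mulZ e P)) ≗ factor ε e′ (normalise K (subst-x P))
  normalise-mulZ K e e′ P h m =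
    trans (cong (λ z → ε ^ K * z) (subst-x-⊞ P (𝟘 ∷ shiftPoly e P) m′))
      (trans (cong (λ z → ε ^ K * (s m′ + (+ 0 + ε * z))) (subst-x-shiftPoly e P (m′ - a)))
        (trans (cong (λ z → ε ^ K * (s m′ + (+ 0 + ε * s z))) (argument (+ e′) h))
          (distribute (ε ^ K) ε (s m′) (s (m - + e′ - - (a * + K))))))
    where
    s = subst-x P
    m′ = m - - (a * + K)
    rearrange : ∀ m k a e → m - - (a * k) - a - e ≡ m - (e + a) - - (a * k)
    rearrange = solve-∀
    argument : ∀ E → E ≡ + e + a → m′ - a - + e ≡ m - E - - (a * + K)
    argument .(+ e + a) refl = rearrange m (+ K) a (+ e)
    distribute : ∀ p e x y → p * (x + (+ 0 + e * y)) ≡ p * x + e * (p * y)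
    distribute = solve-∀

  normalise-mulW : ε * ε ≡ + 1 → ∀ K e e′ P → + e′ ≡ + e - a →
                   normalise (suc K) (subst-x (mulW e P)) ≗ factor ε e′ (normalise K (subst-x P))
  normalise-mulW εε K e e′ P h m =
    trans (cong (λ z → ε * ε ^ K * z) (subst-x-⊞ (𝟘 ∷ P) (shiftPoly e P) m′))
      (trans (cong (λ z → ε * ε ^ K * (+ 0 + ε * s (m′ - a) + z)) (subst-x-shiftPoly e P m′))
        (trans (cong₂ (λ z z′ → ε * ε ^ K * (+ 0 + ε * s z + s z′)) (lower m (+ K) a) (argument (+ e′) h))
          (trans (distribute ε (ε ^ K) (s (m - - (a * + K))) (s (m - + e′ - - (a * + K))))
            (trans (cong (λ z → z * (ε ^ K * s (m - - (a * + K))) + ε * (ε ^ K * s (m - + e′ - - (a * + K)))) εε)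
              (cong (λ z → z + ε * (ε ^ K * s (m - + e′ - - (a * + K)))) (ZP.*-identityˡ (ε ^ K * s (m - - (a * + K)))))))))
    where
    s = subst-x P
    m′ = m - - (a * + suc K)
    lower : ∀ m k a → m - - (a * (+ 1 + k)) - a ≡ m - - (a * k)
    lower = solve-∀
    rearrange : ∀ m k a e → m - - (a * (+ 1 + k)) - e ≡ m - (e - a) - - (a * k)
    rearrange = solve-∀
    argument : ∀ E → E ≡ + e - a → m′ - + e ≡ m - E - - (a * + K)
    argument .(+ e - a) refl = rearrange m (+ K) a (+ e)
    distribute : ∀ e p x y → e * p * (+ 0 + e * x + y) ≡ (e * e) * (p * x) + e * (p * y)
    distribute = solve-∀

  normalise-base : normalise 0 (subst-x (𝟙 ∷ [])) ≗ 𝟙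
  normalise-base m =
    trans (ZP.*-identityˡ _)
      (trans (cong (λ z → 𝟙 z + ε * + 0) (lemma m a))
        (trans (cong (λ z → 𝟙 m + z) (ZP.*-zeroʳ ε)) (ZP.+-identityʳ _)))
    where
    lemma : ∀ m a → m - - (a * + 0) ≡ m
    lemma = solve-∀

-- The hypotheses u ≥ 2 and w ≥ 1 are used (only) to see that every term is determined
-- modulo q^L when L ≤ X.
module TripleProduct (u w : ℕ) (2≤u : 2 N.≤ u) (1≤w : 1 N.≤ w) (ε : ℤ) (ε²≡1 : ε * ε ≡ + 1) where


  c : ℕ
  c = u N.+ w

  open CoefficientLaw c public
  open Substitution ε (- + w) public

  zFactors wFactors : ℕ → List Factor
  zFactors zero = []
  zFactors (suc n) = (ε , c N.* n N.+ u) ∷ zFactors n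
  wFactors zero = []
  wFactors (suc n) = (ε , c N.* n N.+ w) ∷ wFactors n

  private
    z-exponent : ∀ n → + (c N.* n N.+ u) ≡ + (c N.* suc n) + - + w
    z-exponent n =
      trans (sym (cancel (+ (c N.* n N.+ u)) (+ w)))
        (cong (λ k → + k + - + w) (sym (trans (NP.*-suc c n) (regroup (c N.* n)))))
      where
      cancel : ∀ x w → x + w + - w ≡ x
      cancel = solve-∀
      regroup : ∀ m → u N.+ w N.+ m ≡ m N.+ u N.+ w
      regroup m = trans (NP.+-comm (u N.+ w) m) (sym (NP.+-assoc m u w))

    w-exponent : ∀ n → + (c N.* n N.+ w) ≡ + (c N.* n) - - + w
    w-exponent n = cong (λ z → + (c N.* n) + z) (sym (ZP.neg-involutive (+ w)))

  prod-PW : ∀ K → normalise K (subst-x (PW K)) ≗ prod (wFactors K) 𝟙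
  prod-PW zero = normalise-base
  prod-PW (suc K) =
    ≗-trans (normalise-mulW ε²≡1 K (c N.* K) (c N.* K N.+ w) (PW K) (w-exponent K))
      (factor-cong ε (c N.* K N.+ w) (prod-PW K))

  prod-PZ : ∀ N K → normalise K (subst-x (PZ N K)) ≗ prod (zFactors N) (prod (wFactors K) 𝟙)
  prod-PZ zero K = prod-PW K
  prod-PZ (suc N) K =
    ≗-trans (normalise-mulZ K (c N.* suc N) (c N.* N N.+ u) (PZ N K) (z-exponent N))
      (factor-cong ε (c N.* N N.+ u) (prod-PZ N K))

  -- the exponent w (K - i) that x^i contributes after substitution and normalisation
  xExp : ℕ → ℕ → ℤ
  xExp K i = - (- + w * + K) + - + w * + i

  expanded : ∀ N K R → poch R (prod (zFactors N) (prod (wFactors K) 𝟙)) ≗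
             ∑ (suc (N N.+ K)) (λ i → (ε ^ K * ε ^ i) · shift (xExp K i) (poch R (coef i (PZ N K))))
  expanded N K R =
    begin
      poch R (prod (zFactors N) (prod (wFactors K) 𝟙))
    ≈⟨ prod-cong (pochFactors R) (≗-sym (prod-PZ N K)) ⟩
      poch R ((ε ^ K) · shift d (subst-x P))
    ≈⟨ prod-cong (pochFactors R) (·-cong (ε ^ K) (shift-cong d (subst-x-∑ P))) ⟩
      poch R ((ε ^ K) · shift d (∑ n g))
    ≈⟨ ≗-trans (prod-· (pochFactors R) (ε ^ K) _) (·-cong (ε ^ K) (prod-shift (pochFactors R) d _)) ⟩
      (ε ^ K) · shift d (poch R (∑ n g))
    ≈⟨ ·-cong (ε ^ K) (≗-trans (shift-cong d (prod-∑ (pochFactors R) n g)) (shift-∑ d n _)) ⟩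
      (ε ^ K) · ∑ n (λ i → shift d (poch R (g i)))
    ≈⟨ ≗-trans (·-∑ (ε ^ K) n _) (∑-cong n (λ i _ → summand i)) ⟩
      ∑ n (λ i → (ε ^ K * ε ^ i) · shift (xExp K i) (poch R (coef i P)))
    ≈⟨ (λ m → cong (λ k → ∑ k (λ i → (ε ^ K * ε ^ i) · shift (xExp K i) (poch R (coef i P))) m) (length-PZ N K)) ⟩
      ∑ (suc (N N.+ K)) (λ i → (ε ^ K * ε ^ i) · shift (xExp K i) (poch R (coef i P)))
    ∎
    where
    open ≗-Reasoning
    P = PZ N K
    d = - (- + w * + K)
    n = length P
    g : ℕ → Series
    g i = (ε ^ i) · shift (- + w * + i) (coef i P)
    summand : ∀ i → (ε ^ K) · shift d (poch R (g i)) ≗ (ε ^ K * ε ^ i) · shift (xExp K i) (poch R (coef i P))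
    summand i m =
      trans (cong (λ z → ε ^ K * z)
              (trans (prod-· (pochFactors R) (ε ^ i) _ (m - d))
                (cong (λ z → ε ^ i * z) (prod-shift (pochFactors R) (- + w * + i) (coef i P) (m - d)))))
        (trans (sym (ZP.*-assoc (ε ^ K) (ε ^ i) _))
          (cong (λ z → ε ^ K * ε ^ i * poch R (coef i P) z) (merge m d (- + w * + i))))
      where
      merge : ∀ m d e → m - d - e ≡ m - (d + e)
      merge = solve-∀

  -- Truncation.  All factors of (q^c;q^c)_r have positive exponents, so they can be
  -- cancelled; and (q^c;q^c)_R agrees with (q^c;q^c)_{r₀} below q^{c(r₀+1)}.
  private
    1≤c : 1 N.≤ c
    1≤c = NP.≤-trans 1≤w (NP.m≤n+m w u)

  pochFactors-positive : ∀ r → PositiveExponents (pochFactors r)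
  pochFactors-positive zero = []
  pochFactors-positive (suc r) = NP.≤-trans 1≤c (NP.m≤m*n c (suc r)) ∷ pochFactors-positive r

  poch-supported : ∀ r {f} → SupportedFrom (+ 0) f → SupportedFrom (+ 0) (poch r f)
  poch-supported r = prod-supported (pochFactors r)

  -- [x^i] PZ N K is supported from c T(i - K), because (a)_i (a)_r times it is.
  coef-supported : ∀ N K i r → i N.+ r ≡ N N.+ K → SupportedFrom (c*T (+ i - + K)) (coef i (PZ N K))
  coef-supported N K i r eq =
    prod-cancel (pochFactors i) (pochFactors-positive i) (PZ-supported N K i) 𝟘-supported
      (prod-cancel (pochFactors r) (pochFactors-positive r)
        (poch-supported i (PZ-supported N K i)) (poch-supported i 𝟘-supported) below)
    where
    t = c*T (+ i - + K)
    shifted : SupportedFrom t (shift t (poch (N N.+ K) 𝟙))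
    shifted = subst (λ z → SupportedFrom z (shift t (poch (N N.+ K) 𝟙))) (ZP.+-identityˡ t)
                (shift-supported t (poch-supported (N N.+ K) 𝟙-supported))
    below : poch₂ r i (coef i (PZ N K)) ≡[ t ] poch₂ r i 𝟘
    below m lt = trans (law-PZ N K i r eq m) (trans (shifted m lt) (sym (poch₂-𝟘 r i m)))

  poch-stable : ∀ {L} r₀ R g → r₀ ≤′ R → SupportedFrom (+ 0) g → L ≤ + (c N.* suc r₀) → poch R g ≡[ L ] poch r₀ g
  poch-stable r₀ .r₀ g ≤′-refl s le = ≡[]-refl
  poch-stable r₀ (suc R) g (≤′-step r₀≤′R) s le =
    ≡[]-trans (factor-≡[]-id -[1+ 0 ] (c N.* suc R) (poch-supported R s)
                (ZP.≤-trans le (+≤+ (NP.*-monoʳ-≤ c (s≤s (NP.≤′⇒≤ r₀≤′R))))))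
              (poch-stable r₀ R g r₀≤′R s le)

  coef-truncated : ∀ N K i r R r₀ {L} → i N.+ r ≡ N N.+ K → r₀ N.≤ i → r₀ N.≤ r → r₀ N.≤ R →
                   L ≤ + (c N.* suc r₀) → poch R (coef i (PZ N K)) ≡[ L ] shift (c*T (+ i - + K)) 𝟙
  coef-truncated N K i r R r₀ {L} eq r₀≤i r₀≤r r₀≤R le =
    prod-cancel (pochFactors i) (pochFactors-positive i) (poch-supported R p-supported) monomial-supported
      (prod-cancel (pochFactors r) (pochFactors-positive r)
        (poch-supported i (poch-supported R p-supported)) (poch-supported i monomial-supported) both)
    where
    t = c*T (+ i - + K)
    M = N N.+ K
    p = coef i (PZ N K)
    p-supported = PZ-supported N K i
    monomial-supported : SupportedFrom (+ 0) (shift t 𝟙)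
    monomial-supported = supported-weaken (subst (+ 0 ≤_) (sym (ZP.+-identityˡ t)) (c*T-nonneg (+ i - + K)))
                    (shift-supported t 𝟙-supported)
    r₀≤M : r₀ N.≤ M
    r₀≤M = subst (r₀ N.≤_) eq (NP.≤-trans r₀≤i (NP.m≤m+n i r))
    left : poch₂ r i (poch R p) ≗ shift t (poch R (poch M 𝟙))
    left = ≗-trans (prod-cong (pochFactors r) (prod-prod (pochFactors i) (pochFactors R) p))
             (≗-trans (prod-prod (pochFactors r) (pochFactors R) (poch i p))
               (≗-trans (prod-cong (pochFactors R) (law-PZ N K i r eq)) (prod-shift (pochFactors R) t _)))
    -- both products of (q^c;q^c) symbols reduce to (q^c;q^c)_{r₀}² below q^L
    middle : poch R (poch M 𝟙) ≡[ L ] poch₂ r i 𝟙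
    middle = ≡[]-trans (prod-≡[] (pochFactors R) (poch-stable r₀ M 𝟙 (NP.≤⇒≤′ r₀≤M) 𝟙-supported le))
               (≡[]-trans (poch-stable r₀ R (poch r₀ 𝟙) (NP.≤⇒≤′ r₀≤R) (poch-supported r₀ 𝟙-supported) le)
                 (≡[]-sym (≡[]-trans (prod-≡[] (pochFactors r) (poch-stable r₀ i 𝟙 (NP.≤⇒≤′ r₀≤i) 𝟙-supported le))
                                     (poch-stable r₀ r (poch r₀ 𝟙) (NP.≤⇒≤′ r₀≤r) (poch-supported r₀ 𝟙-supported) le))))
    both : poch₂ r i (poch R p) ≡[ L ] poch₂ r i (shift t 𝟙)
    both m lt = trans (left m)
                  (trans (shift-≡[]-nonneg t (c*T-nonneg (+ i - + K)) middle m lt)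
                    (sym (poch₂-shift r i t 𝟙 m)))

  -- A term q^s (a)_R [x^i] P is determined modulo q^L when L is below its lowest possible
  -- exponent s + c T(i-K), or when L - s is below a factor 1 - q^{c(r₀+1)} that can be cancelled.
  Truncatable : ℕ → ℕ → ℕ → ℤ → ℤ → ℤ → Set
  Truncatable i r R L s t = (L ≤ s + t) ⊎ (Σ[ r₀ ∈ ℕ ] (r₀ N.≤ i × r₀ N.≤ r × r₀ N.≤ R × L - s ≤ + (c N.* suc r₀)))

  term-truncated : ∀ N K i r R L s → i N.+ r ≡ N N.+ K → Truncatable i r R L s (c*T (+ i - + K)) →
                   shift s (poch R (coef i (PZ N K))) ≡[ L ] shift (s + c*T (+ i - + K)) 𝟙
  term-truncated N K i r R L s eq (inj₁ le) =
    supported⇒≡[] (subst (λ z → SupportedFrom z (shift s (poch R (coef i (PZ N K))))) (ZP.+-comm t s)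
                     (shift-supported s (prod-supported (pochFactors R) (coef-supported N K i r eq))))
                   (subst (λ z → SupportedFrom z (shift (s + t) 𝟙)) (ZP.+-identityˡ (s + t))
                     (shift-supported (s + t) 𝟙-supported))
                   le
    where t = c*T (+ i - + K)
  term-truncated N K i r R L s eq (inj₂ (r₀ , r₀≤i , r₀≤r , r₀≤R , le)) m lt =
    trans (shift-≡[] s (coef-truncated N K i r R r₀ eq r₀≤i r₀≤r r₀≤R le) m lt)
          (shift-shift s (c*T (+ i - + K)) 𝟙 m)

  triple-product-expanded :
    ∀ X R L → (∀ i r → i N.+ r ≡ X N.+ X → Truncatable i r R L (xExp X i) (c*T (+ i - + X))) →
    poch R (prod (zFactors X) (prod (wFactors X) 𝟙)) ≡[ L ]
    ∑ (suc (X N.+ X)) (λ i → (ε ^ X * ε ^ i) · shift (xExp X i + c*T (+ i - + X)) 𝟙)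
  triple-product-expanded X R L truncatable =
    ≡[]-trans (≗⇒≡[] L (expanded X X R))
      (∑-≡[] (suc (X N.+ X)) (λ i lt → ·-≡[] (ε ^ X * ε ^ i)
        (term-truncated X X i (X N.+ X N.∸ i) R L (xExp X i) (complement lt)
          (truncatable i _ (complement lt)))))
    where
    complement : ∀ {i} → i N.< suc (X N.+ X) → i N.+ (X N.+ X N.∸ i) ≡ X N.+ X
    complement lt = NP.m+[n∸m]≡n (NP.≤-pred lt)

  above-exponent : ∀ X d → xExp X (X N.+ d) + c*T (+ (X N.+ d) - + X) ≡ + (u N.* d) + c*T (+ d - + 1)
  above-exponent X d =
    begin
      xExp X (X N.+ d) + c*T (+ (X N.+ d) - + X)
    ≡⟨ cong (λ j → xExp X (X N.+ d) + c*T j) (cancel (+ X) (+ d)) ⟩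
      xExp X (X N.+ d) + + c * + triℤ (+ d)
    ≡⟨ cong (λ z → xExp X (X N.+ d) + + c * z) (sym (triℤ-step (+ d))) ⟩
      xExp X (X N.+ d) + + c * (+ triℤ (+ d - + 1) + + d)
    ≡⟨ lemma (+ u) (+ w) (+ X) (+ d) (+ triℤ (+ d - + 1)) ⟩
      + u * + d + c*T (+ d - + 1)
    ≡⟨ cong (λ z → z + c*T (+ d - + 1)) (sym (ZP.pos-* u d)) ⟩
      + (u N.* d) + c*T (+ d - + 1)
    ∎
    where
    open ≡-Reasoning
    cancel : ∀ X d → X + d - X ≡ d
    cancel = solve-∀
    lemma : ∀ u w X d T → - (- w * X) + - w * (X + d) + (u + w) * (T + d) ≡ u * d + (u + w) * T
    lemma = solve-∀

  below-exponent : ∀ i t → xExp (i N.+ suc t) i + c*T (+ i - + (i N.+ suc t)) ≡ + (w N.* suc t) + c*T (+ t)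
  below-exponent i t =
    cong₂ _+_ (trans (weight (+ w) (+ i) (+ suc t)) (sym (ZP.pos-* w (suc t))))
              (cong c*T (difference (+ i) (+ suc t)))
    where
    weight : ∀ w i s → - (- w * (i + s)) + - w * i ≡ w * s
    weight = solve-∀
    difference : ∀ i s → i - (i + s) ≡ - s
    difference = solve-∀

  private
    ε^-square : ∀ k → ε ^ k * ε ^ k ≡ + 1
    ε^-square zero = refl
    ε^-square (suc k) = trans (regroup ε (ε ^ k)) (cong₂ _*_ ε²≡1 (ε^-square k))
      where
      regroup : ∀ e p → e * p * (e * p) ≡ (e * e) * (p * p)
      regroup = solve-∀

  above-sign : ∀ X d → ε ^ X * ε ^ (X N.+ d) ≡ ε ^ d
  above-sign X d =
    trans (cong (λ z → ε ^ X * z) (ZP.^-distribˡ-+-* ε X d))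
      (trans (sym (ZP.*-assoc (ε ^ X) (ε ^ X) (ε ^ d)))
        (trans (cong (λ z → z * ε ^ d) (ε^-square X)) (ZP.*-identityˡ (ε ^ d))))

  below-sign : ∀ i s → ε ^ (i N.+ s) * ε ^ i ≡ ε ^ s
  below-sign i s =
    trans (cong (λ z → z * ε ^ i) (trans (ZP.^-distribˡ-+-* ε i s) (ZP.*-comm (ε ^ i) (ε ^ s))))
      (trans (ZP.*-assoc (ε ^ s) (ε ^ i) (ε ^ i))
        (trans (cong (λ z → ε ^ s * z) (ε^-square i)) (ZP.*-identityʳ (ε ^ s))))

  private
    n≤c*n : ∀ n → n N.≤ c N.* n
    n≤c*n n = subst (N._≤ c N.* n) (NP.*-identityˡ n) (NP.*-monoˡ-≤ n 1≤c)

    n≤w*n : ∀ n → n N.≤ w N.* n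
    n≤w*n n = subst (N._≤ w N.* n) (NP.*-identityˡ n) (NP.*-monoˡ-≤ n 1≤w)

    double≤u* : ∀ n → n N.+ n N.≤ u N.* n
    double≤u* n = subst (N._≤ u N.* n) (cong (n N.+_) (NP.+-identityʳ n)) (NP.*-monoˡ-≤ n 2≤u)

    -- for i = X + d with u d < L ≤ X the factor 1 - q^{c(r+1)}, r = X - d, can be cancelled
    bound-above : ∀ L X r d → u N.* d N.< L → L N.≤ X → r N.+ d ≡ X → L N.+ w N.* d N.≤ c N.* suc r
    bound-above L X r d ud<L L≤X r+d≡X =
      begin
        L N.+ w N.* d
      ≤⟨ NP.+-monoˡ-≤ (w N.* d) L≤X ⟩
        X N.+ w N.* d
      ≡⟨ cong (N._+ w N.* d) (sym r+d≡X) ⟩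
        r N.+ d N.+ w N.* d
      ≤⟨ NP.+-mono-≤ (NP.+-mono-≤ (NP.n≤1+n r) d≤1+r) (NP.*-monoʳ-≤ w d≤1+r) ⟩
        suc r N.+ suc r N.+ w N.* suc r
      ≤⟨ NP.+-monoˡ-≤ (w N.* suc r) (double≤u* (suc r)) ⟩
        u N.* suc r N.+ w N.* suc r
      ≡⟨ sym (NP.*-distribʳ-+ (suc r) u w) ⟩
        c N.* suc r
      ∎
      where
      open NP.≤-Reasoning
      -- d + d ≤ u d < L ≤ X = r + d, so d < r
      d<r : d N.< r
      d<r = NP.+-cancelʳ-≤ d (suc d) r
              (NP.≤-trans (s≤s (double≤u* d)) (NP.≤-trans ud<L (NP.≤-trans L≤X (NP.≤-reflexive (sym r+d≡X)))))
      d≤1+r : d N.≤ suc r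
      d≤1+r = NP.m≤n⇒m≤1+n (NP.<⇒≤ d<r)

    -- for i < X, i + t + 1 = X, the factor 1 - q^{c(i+1)} can be cancelled
    bound-below : ∀ L i t → L N.≤ i N.+ suc t → L N.≤ c N.* suc i N.+ w N.* suc t
    bound-below L i t h = NP.≤-trans h (NP.+-mono-≤ (NP.≤-trans (NP.n≤1+n i) (n≤c*n (suc i))) (n≤w*n (suc t)))

    ≤-+-nonneg : ∀ a {b} → + 0 ≤ b → a ≤ a + b
    ≤-+-nonneg a 0≤b = ZP.≤-trans (ZP.≤-reflexive (sym (ZP.+-identityʳ a))) (ZP.+-monoʳ-≤ a 0≤b)

  truncatable : ∀ X L → L N.≤ X → ∀ i r → i N.+ r ≡ X N.+ X →
                Truncatable i r X (+ L) (xExp X i) (c*T (+ i - + X))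
  truncatable X L L≤X i r eq with X N.≤? i
  ... | yes X≤i with NP.m≤n⇒∃[o]m+o≡n X≤i
  ...   | d , refl with L N.≤? u N.* d
  ...     | yes L≤ud =
    inj₁ (subst (+ L ≤_) (sym (above-exponent X d))
           (ZP.≤-trans (+≤+ L≤ud) (≤-+-nonneg (+ (u N.* d)) (c*T-nonneg (+ d - + 1)))))
  ...     | no L≰ud =
    inj₂ (r , NP.≤-trans r≤X (NP.m≤m+n X d) , NP.≤-refl , r≤X ,
          subst (_≤ + (c N.* suc r)) (sym shifted) (+≤+ (bound-above L X r d (NP.≰⇒> L≰ud) L≤X r+d≡X)))
    where
    r+d≡X : r N.+ d ≡ X
    r+d≡X = trans (NP.+-comm r d) (NP.+-cancelˡ-≡ X _ _ (trans (sym (NP.+-assoc X d r)) eq))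
    r≤X : r N.≤ X
    r≤X = subst (r N.≤_) r+d≡X (NP.m≤m+n r d)
    shifted : + L - xExp X (X N.+ d) ≡ + (L N.+ w N.* d)
    shifted = trans (lemma (+ L) (+ w) (+ X) (+ d)) (cong (λ z → + L + z) (sym (ZP.pos-* w d)))
      where
      lemma : ∀ L w X d → L - (- (- w * X) + - w * (X + d)) ≡ L + w * d
      lemma = solve-∀
  truncatable X L L≤X i r eq | no X≰i with NP.m≤n⇒∃[o]m+o≡n (NP.≰⇒> X≰i)
  ... | t , 1+i+t≡X with trans (NP.+-suc i t) 1+i+t≡X
  ...   | refl =
    inj₂ (i , NP.≤-refl , i≤r , i≤X ,
          subst (λ z → + L - z ≤ + (c N.* suc i)) (sym xExp≡) (lower (bound-below L i t L≤X)))
    where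
    i≤X : i N.≤ i N.+ suc t
    i≤X = NP.m≤m+n i (suc t)
    i≤r : i N.≤ r
    i≤r = NP.+-cancelˡ-≤ i i r (subst (i N.+ i N.≤_) (sym eq) (NP.+-mono-≤ i≤X i≤X))
    xExp≡ : xExp (i N.+ suc t) i ≡ + (w N.* suc t)
    xExp≡ = trans (weight (+ w) (+ i) (+ suc t)) (sym (ZP.pos-* w (suc t)))
      where
      weight : ∀ w i s → - (- w * (i + s)) + - w * i ≡ w * s
      weight = solve-∀
    lower : ∀ {a b} → L N.≤ a N.+ b → + L - + b ≤ + a
    lower {a} {b} h = subst (+ L - + b ≤_) (cancel (+ a) (+ b)) (ZP.+-monoˡ-≤ (- + b) (+≤+ h))
      where
      cancel : ∀ a b → a + b - b ≡ a
      cancel = solve-∀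

  -- The right-hand side Σ_{|j| ≤ X} ε^j q^{c T(j) - w j}, written as the j = 0 term plus
  -- the pairs j = t + 1 (exponent u (t+1) + c T(t)) and j = -(t + 1) (exponent w (t+1) + c T(t)).
  tripleSum : ℕ → Series
  tripleSum X = 𝟙 ⊕ ∑ X (λ t → (ε ^ suc t) · (shift (+ (u N.* suc t) + c*T (+ t)) 𝟙 ⊕ shift (+ (w N.* suc t) + c*T (+ t)) 𝟙))

  symmetric-form : ∀ X → ∑ (suc (X N.+ X)) (λ i → (ε ^ X * ε ^ i) · shift (xExp X i + c*T (+ i - + X)) 𝟙) ≗ tripleSum X
  symmetric-form X =
    ≗-trans (∑-centre X F)
      (⊕-cong centre
        (∑-cong X (λ t t<X → ≗-trans (⊕-cong (above t) (below t t<X)) (≗-sym (·-⊕ (ε ^ suc t) _ _)))))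
    where
    F : ℕ → Series
    F i = (ε ^ X * ε ^ i) · shift (xExp X i + c*T (+ i - + X)) 𝟙
    centre : F X ≗ 𝟙
    centre m =
      trans (cong₂ (λ s e → s * 𝟙 (m - e)) (ε^-square X) exponent)
        (trans (ZP.*-identityˡ _) (cong 𝟙 (ZP.+-identityʳ m)))
      where
      vanishes : ∀ w X → - (- w * X) + - w * X ≡ + 0
      vanishes = solve-∀
      exponent : xExp X X + c*T (+ X - + X) ≡ + 0
      exponent = trans (cong₂ _+_ (vanishes (+ w) (+ X)) (cong c*T (ZP.+-inverseʳ (+ X)))) (trans (ZP.+-identityˡ _) (ZP.*-zeroʳ (+ c)))
    above : ∀ t → F (X N.+ suc t) ≗ (ε ^ suc t) · shift (+ (u N.* suc t) + c*T (+ t)) 𝟙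
    above t m = cong₂ (λ s e → s * 𝟙 (m - e)) (above-sign X (suc t)) (above-exponent X (suc t))
    below′ : ∀ i t → (ε ^ (i N.+ suc t) * ε ^ i) · shift (xExp (i N.+ suc t) i + c*T (+ i - + (i N.+ suc t))) 𝟙
                     ≗ (ε ^ suc t) · shift (+ (w N.* suc t) + c*T (+ t)) 𝟙
    below′ i t m = cong₂ (λ s e → s * 𝟙 (m - e)) (below-sign i (suc t)) (below-exponent i t)
    below : ∀ t → t N.< X → F (X N.∸ suc t) ≗ (ε ^ suc t) · shift (+ (w N.* suc t) + c*T (+ t)) 𝟙
    below t t<X = subst (λ Y → (ε ^ Y * ε ^ (X N.∸ suc t)) · shift (xExp Y (X N.∸ suc t) + c*T (+ (X N.∸ suc t) - + Y)) 𝟙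
                               ≗ (ε ^ suc t) · shift (+ (w N.* suc t) + c*T (+ t)) 𝟙)
                        (NP.m∸n+n≡m t<X) (below′ (X N.∸ suc t) t)

  triple-product : ∀ X L → L N.≤ X → poch X (prod (zFactors X) (prod (wFactors X) 𝟙)) ≡[ + L ] tripleSum X
  triple-product X L L≤X =
    ≡[]-trans (triple-product-expanded X X (+ L) (truncatable X L L≤X)) (≗⇒≡[] (+ L) (symmetric-form X))

-- Euler's pentagonal theorem for E(q⁴) = ∏_{k≥1} (1 - q^{4k}), modulo q^{n+1}: the triple
-- product with c = 12, w = 8, ε = -1, whose terms are (-1)^j q^{2j(3j∓1)}.
module Pentagonal = TripleProduct 4 8 (s≤s (s≤s z≤n)) (s≤s z≤n) -[1+ 0 ] refl
module Base4 = CoefficientLaw 4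

euler⁴ : ℕ → Series → Series
euler⁴ k = prod (Base4.pochFactors k)

pentExp⁻ pentExp⁺ : ℕ → ℕ
pentExp⁻ j = 2 N.* j N.* (3 N.* j N.∸ 1)
pentExp⁺ j = 2 N.* j N.* (3 N.* j N.+ 1)

pentTerm : ℕ → Series → Series
pentTerm j f = sgn j · (shift (+ pentExp⁻ j) f ⊕ shift (+ pentExp⁺ j) f)

pentSum : ℕ → Series → Series
pentSum zero f = 𝟘
pentSum (suc N) f = pentSum N f ⊕ pentTerm (suc N) f

pentSum-∑ : ∀ N f → pentSum N f ≗ ∑ N (λ t → pentTerm (suc t) f)
pentSum-∑ zero f = ≗-refl
pentSum-∑ (suc N) f =
  ≗-trans (⊕-congˡ (pentTerm (suc N) f) (pentSum-∑ N f)) (≗-sym (∑-snoc N (λ t → pentTerm (suc t) f)))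

sgn-power : ∀ k → -[1+ 0 ] ^ k ≡ sgn k
sgn-power zero = refl
sgn-power (suc zero) = refl
sgn-power (suc (suc k)) = trans (negate-twice (-[1+ 0 ] ^ k)) (sgn-power k)
  where
  negate-twice : ∀ x → - + 1 * (- + 1 * x) ≡ x
  negate-twice = solve-∀

private
  pentExp⁻-tri : ∀ t → 4 N.* suc t N.+ 12 N.* tri t ≡ pentExp⁻ (suc t)
  pentExp⁻-tri t =
    trans (expand t (tri t))
      (trans (cong (λ z → 4 N.* suc t N.+ 6 N.* z) (double-tri t))
        (trans (collect t) (cong (λ z → 2 N.* suc t N.* (z N.∸ 1)) (sym (triple t)))))
    where
    expand : ∀ t a → 4 N.* suc t N.+ 12 N.* a ≡ 4 N.* suc t N.+ 6 N.* (2 N.* a)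
    expand = NatSolver.solve-∀
    collect : ∀ t → 4 N.* suc t N.+ 6 N.* (t N.* suc t) ≡ 2 N.* suc t N.* (3 N.* t N.+ 2)
    collect = NatSolver.solve-∀
    triple : ∀ t → 3 N.* suc t ≡ suc (3 N.* t N.+ 2)
    triple = NatSolver.solve-∀

  pentExp⁺-tri : ∀ t → 8 N.* suc t N.+ 12 N.* tri t ≡ pentExp⁺ (suc t)
  pentExp⁺-tri t =
    trans (expand t (tri t)) (trans (cong (λ z → 8 N.* suc t N.+ 6 N.* z) (double-tri t)) (collect t))
    where
    expand : ∀ t a → 8 N.* suc t N.+ 12 N.* a ≡ 8 N.* suc t N.+ 6 N.* (2 N.* a)
    expand = NatSolver.solve-∀
    collect : ∀ t → 8 N.* suc t N.+ 6 N.* (t N.* suc t) ≡ 2 N.* suc t N.* (3 N.* suc t N.+ 1)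
    collect = NatSolver.solve-∀

  pentagonal-exponent : ∀ a t e → a N.+ 12 N.* tri t ≡ e → + a + Pentagonal.c*T (+ t) ≡ + e
  pentagonal-exponent a t e h = trans (cong (λ z → + a + z) (sym (ZP.pos-* 12 (tri t)))) (cong +_ h)

pentagonal-sum : ∀ X → Pentagonal.tripleSum X ≗ 𝟙 ⊕ pentSum X 𝟙
pentagonal-sum X =
  ⊕-congʳ 𝟙 (≗-trans (∑-cong X (λ t _ m → cong₂ _*_ (sgn-power (suc t))
                          (cong₂ _+_ (cong (λ e → 𝟙 (m - e)) (pentagonal-exponent _ t _ (pentExp⁻-tri t)))
                                     (cong (λ e → 𝟙 (m - e)) (pentagonal-exponent _ t _ (pentExp⁺-tri t))))))
                       (≗-sym (pentSum-∑ X 𝟙)))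

pentTerm-vanishes : ∀ n → pentTerm (suc n) 𝟙 ≡[ + suc n ] 𝟘
pentTerm-vanishes n =
  ·-supported (sgn (suc n)) (⊕-supported (high (pentExp⁻ (suc n)) below⁻) (high (pentExp⁺ (suc n)) below⁺))
  where
  high : ∀ e → suc n N.≤ e → SupportedFrom (+ suc n) (shift (+ e) 𝟙)
  high e le = supported-weaken {t = + 0 + + e} (+≤+ le) (shift-supported (+ e) 𝟙-supported)
  below⁻ : suc n N.≤ pentExp⁻ (suc n)
  below⁻ = subst (suc n N.≤_) (pentExp⁻-tri n) (NP.≤-trans (NP.m≤n*m (suc n) 4) (NP.m≤m+n _ _))
  below⁺ : suc n N.≤ pentExp⁺ (suc n)
  below⁺ = subst (suc n N.≤_) (pentExp⁺-tri n) (NP.≤-trans (NP.m≤n*m (suc n) 8) (NP.m≤m+n _ _))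

-- The three products of the triple product merge into ∏_{j ≤ 3X} (1 - q^{4j}):
-- (1 - q^{12k})(1 - q^{12k-4})(1 - q^{12k-8}) = (1 - q^{4·3k})(1 - q^{4(3k-1)})(1 - q^{4(3k-2)}).
euler⁴-factorisation : ∀ X f →
  Pentagonal.poch X (prod (Pentagonal.zFactors X) (prod (Pentagonal.wFactors X) f)) ≗ euler⁴ (3 N.* X) f
euler⁴-factorisation zero f = ≗-refl
euler⁴-factorisation (suc X) f =
  begin
    factor σ a (poch₁₂ (factor σ z (Z (factor σ w (W f)))))
  ≈⟨ factor-cong σ a (prod-cong (Pentagonal.pochFactors X) (factor-cong σ z (prod-factor (Pentagonal.zFactors X) σ w (W f)))) ⟩
    factor σ a (poch₁₂ (factor σ z (factor σ w (Z (W f)))))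
  ≈⟨ factor-cong σ a (≗-trans (prod-factor (Pentagonal.pochFactors X) σ z _)
                         (factor-cong σ z (prod-factor (Pentagonal.pochFactors X) σ w (Z (W f))))) ⟩
    factor σ a (factor σ z (factor σ w (poch₁₂ (Z (W f)))))
  ≈⟨ factor-cong σ a (factor-cong σ z (factor-cong σ w (euler⁴-factorisation X f))) ⟩
    factor σ a (factor σ z (factor σ w (euler⁴ (3 N.* X) f)))
  ≈⟨ factor-cong σ a (factor-comm σ z σ w (euler⁴ (3 N.* X) f)) ⟩
    factor σ a (factor σ w (factor σ z (euler⁴ (3 N.* X) f)))
  ≈⟨ ≗-trans (factor-≡ σ (factor σ w (factor σ z E)) (sym (times-four₃ X)))
       (factor-cong σ _ (≗-trans (factor-≡ σ (factor σ z E) (sym (times-four₂ X)))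
                          (factor-cong σ _ (factor-≡ σ E (sym (times-four₁ X)))))) ⟩
    euler⁴ (suc (suc (suc (3 N.* X)))) f
  ≈⟨ (λ m → cong (λ k → euler⁴ k f m) (sym (times-three X))) ⟩
    euler⁴ (3 N.* suc X) f
  ∎
  where
  open ≗-Reasoning
  σ : ℤ
  σ = -[1+ 0 ]
  a = 12 N.* suc X
  z = 12 N.* X N.+ 4
  w = 12 N.* X N.+ 8
  poch₁₂ = Pentagonal.poch X
  Z = prod (Pentagonal.zFactors X)
  W = prod (Pentagonal.wFactors X)
  E = euler⁴ (3 N.* X) f
  times-three : ∀ X → 3 N.* suc X ≡ suc (suc (suc (3 N.* X)))
  times-three = NatSolver.solve-∀
  times-four₃ : ∀ X → 4 N.* suc (suc (suc (3 N.* X))) ≡ 12 N.* suc X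
  times-four₃ = NatSolver.solve-∀
  times-four₂ : ∀ X → 4 N.* suc (suc (3 N.* X)) ≡ 12 N.* X N.+ 8
  times-four₂ = NatSolver.solve-∀
  times-four₁ : ∀ X → 4 N.* suc (3 N.* X) ≡ 12 N.* X N.+ 4
  times-four₁ = NatSolver.solve-∀

pentagonal : ∀ n → 𝟙 ⊕ pentSum n 𝟙 ≡[ + suc n ] euler⁴ (3 N.* suc n) 𝟙
pentagonal n =
  ≡[]-trans one-more-term
    (≡[]-trans (≗⇒≡[] L (≗-sym (pentagonal-sum X)))
      (≡[]-trans (≡[]-sym (Pentagonal.triple-product X (suc n) NP.≤-refl))
        (≗⇒≡[] L (euler⁴-factorisation X 𝟙))))
  where
  X = suc n
  L = + suc n
  one-more-term : 𝟙 ⊕ pentSum n 𝟙 ≡[ L ] 𝟙 ⊕ pentSum X 𝟙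
  one-more-term m lt =
    cong (λ z → 𝟙 m + z) (sym (trans (cong (λ z → pentSum n 𝟙 m + z) (pentTerm-vanishes n m lt)) (ZP.+-identityʳ _)))

-- Gauss' identity ∏_{k≥1} (1 - q^{4k}) (1 + q^{4k-1}) (1 + q^{4k-3}) = Σ_{k≥0} q^{T(k)}: the
-- triple product with c = 4, w = 1, ε = +1, whose terms are q^{T(2t+2)} and q^{T(2t+1)}.
module Gauss = TripleProduct 3 1 (s≤s (s≤s z≤n)) (s≤s z≤n) (+ 1) refl

triangularSeries : ℕ → Series
triangularSeries K = ∑ K (λ k → shift (+ tri k) 𝟙)

private
  tri-even : ∀ t → 3 N.* suc t N.+ 4 N.* tri t ≡ tri (suc (suc (t N.+ t)))
  tri-even t =
    NP.*-cancelˡ-≡ _ _ 2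
      (trans (expand t (tri t))
        (trans (cong (λ z → 6 N.* suc t N.+ 4 N.* z) (double-tri t))
          (trans (collect t) (sym (double-tri (suc (suc (t N.+ t))))))))
    where
    expand : ∀ t a → 2 N.* (3 N.* suc t N.+ 4 N.* a) ≡ 6 N.* suc t N.+ 4 N.* (2 N.* a)
    expand = NatSolver.solve-∀
    collect : ∀ t → 6 N.* suc t N.+ 4 N.* (t N.* suc t) ≡ suc (suc (t N.+ t)) N.* suc (suc (suc (t N.+ t)))
    collect = NatSolver.solve-∀

  tri-odd : ∀ t → 1 N.* suc t N.+ 4 N.* tri t ≡ tri (suc (t N.+ t))
  tri-odd t =
    NP.*-cancelˡ-≡ _ _ 2
      (trans (expand t (tri t))
        (trans (cong (λ z → 2 N.* suc t N.+ 4 N.* z) (double-tri t))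
          (trans (collect t) (sym (double-tri (suc (t N.+ t)))))))
    where
    expand : ∀ t a → 2 N.* (1 N.* suc t N.+ 4 N.* a) ≡ 2 N.* suc t N.+ 4 N.* (2 N.* a)
    expand = NatSolver.solve-∀
    collect : ∀ t → 2 N.* suc t N.+ 4 N.* (t N.* suc t) ≡ suc (t N.+ t) N.* suc (suc (t N.+ t))
    collect = NatSolver.solve-∀

  gauss-exponent : ∀ a t e → a N.+ 4 N.* tri t ≡ e → + a + Gauss.c*T (+ t) ≡ + e
  gauss-exponent a t e h = trans (cong (λ z → + a + z) (sym (ZP.pos-* 4 (tri t)))) (cong +_ h)

gauss-sum : ∀ X → Gauss.tripleSum X ≗ triangularSeries (suc (X N.+ X))
gauss-sum X =
  ⊕-cong (≗-sym (shift-zero 𝟙))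
    (≗-trans (∑-cong X (λ t _ → pair t)) (≗-sym (∑-pairs X (λ k → shift (+ tri (suc k)) 𝟙))))
  where
  pair : ∀ t → ((+ 1) ^ suc t) · (shift (+ (3 N.* suc t) + Gauss.c*T (+ t)) 𝟙 ⊕ shift (+ (1 N.* suc t) + Gauss.c*T (+ t)) 𝟙)
               ≗ shift (+ tri (suc (t N.+ t))) 𝟙 ⊕ shift (+ tri (suc (suc (t N.+ t)))) 𝟙
  pair t m =
    begin
      (+ 1) ^ suc t * (a + b)
    ≡⟨ cong (λ s → s * (a + b)) (ZP.^-zeroˡ (suc t)) ⟩
      + 1 * (a + b)
    ≡⟨ ZP.*-identityˡ (a + b) ⟩
      a + b
    ≡⟨ ZP.+-comm a b ⟩
      b + a
    ≡⟨ cong₂ (λ e e′ → 𝟙 (m - e) + 𝟙 (m - e′)) (gauss-exponent _ t _ (tri-odd t)) (gauss-exponent _ t _ (tri-even t)) ⟩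
      𝟙 (m - + tri (suc (t N.+ t))) + 𝟙 (m - + tri (suc (suc (t N.+ t))))
    ∎
    where
    open ≡-Reasoning
    a = 𝟙 (m - (+ (3 N.* suc t) + Gauss.c*T (+ t)))
    b = 𝟙 (m - (+ (1 N.* suc t) + Gauss.c*T (+ t)))

-- oddPartsBelow b = Σ_m #{partitions of m into distinct odd parts < b} q^m
--                 = ∏_{odd k < b} (1 + q^k),
-- because the list dpartsBelow (b+1) m adds to dpartsBelow b m the partitions using b.
oddPartsBelow : ℕ → Series
oddPartsBelow b (+ m) = + length (dpartsBelow b m)
oddPartsBelow b -[1+ _ ] = + 0

oddPartsBelow-supported : ∀ b → SupportedFrom (+ 0) (oddPartsBelow b)
oddPartsBelow-supported b -[1+ _ ] _ = refl
oddPartsBelow-supported b (+ m) (+<+ ())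

oddPartsBelow-zero : oddPartsBelow 0 ≗ 𝟙
oddPartsBelow-zero (+ zero) = refl
oddPartsBelow-zero (+ suc m) = refl
oddPartsBelow-zero -[1+ _ ] = refl

oddPartsBelow-odd : ∀ b → b % 2 ≡ 1 → oddPartsBelow (suc b) ≗ factor (+ 1) b (oddPartsBelow b)
oddPartsBelow-odd b odd -[1+ k ] =
  sym (cong (λ z → + 0 + + 1 * z) (oddPartsBelow-supported b (-[1+ k ] - + b) (sub-< -[1+ k ] b (+ 0) -<+)))
oddPartsBelow-odd b odd (+ m) with b % 2 N.≟ 1 | b N.≤? m
... | yes _ | yes b≤m =
  trans (cong +_ count)
    (cong (λ z → + length (dpartsBelow b m) + z)
      (trans (sym (ZP.*-identityˡ _)) (cong (λ z → + 1 * oddPartsBelow b z) (sym exponent))))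
  where
  count : length (map (b ∷_) (dpartsBelow b (m N.∸ b)) ++ dpartsBelow b m) ≡ length (dpartsBelow b m) N.+ length (dpartsBelow b (m N.∸ b))
  count = trans (LP.length-++ (map (b ∷_) (dpartsBelow b (m N.∸ b))))
            (trans (cong (N._+ length (dpartsBelow b m)) (LP.length-map (b ∷_) (dpartsBelow b (m N.∸ b))))
              (NP.+-comm (length (dpartsBelow b (m N.∸ b))) (length (dpartsBelow b m))))
  exponent : + m - + b ≡ + (m N.∸ b)
  exponent = trans (ZP.m-n≡m⊖n m b) (ZP.⊖-≥ b≤m)
... | yes _ | no b≰m =
  sym (trans (cong (λ z → + length (dpartsBelow b m) + + 1 * z) (oddPartsBelow-supported b (+ m - + b) negative))
             (ZP.+-identityʳ _))
  where
  negative : + m - + b < + 0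
  negative = subst (+ m - + b <_) (ZP.+-inverseʳ (+ b)) (ZP.+-monoˡ-< (- + b) (+<+ (NP.≰⇒> b≰m)))
... | no ¬odd | _ = ⊥-elim (¬odd odd)

oddPartsBelow-even : ∀ b → b % 2 ≡ 0 → oddPartsBelow (suc b) ≗ oddPartsBelow b
oddPartsBelow-even b even -[1+ k ] = refl
oddPartsBelow-even b even (+ m) with b % 2 N.≟ 1 | b N.≤? m
... | yes odd | _ = ⊥-elim (0≢1 (trans (sym even) odd))
  where
  0≢1 : 0 ≢ 1
  0≢1 ()
... | no _ | _ = refl

oddPartsBelow-four : ∀ X → oddPartsBelow (4 N.* X) ≗ prod (Gauss.zFactors X) (prod (Gauss.wFactors X) 𝟙)
oddPartsBelow-four zero = oddPartsBelow-zero
oddPartsBelow-four (suc X) =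
  begin
    oddPartsBelow (4 N.* suc X)
  ≈⟨ (λ m → cong (λ k → oddPartsBelow k m) (four-suc X)) ⟩
    oddPartsBelow (suc b₃)
  ≈⟨ ≗-trans (oddPartsBelow-odd b₃ (parity 1 (2 N.* X N.+ 1) (shape₃ X)))
       (factor-cong (+ 1) b₃ (oddPartsBelow-even (suc b₁) (parity 0 (2 N.* X N.+ 1) (shape₂ X)))) ⟩
    factor (+ 1) b₃ (oddPartsBelow (suc b₁))
  ≈⟨ factor-cong (+ 1) b₃ (≗-trans (oddPartsBelow-odd b₁ (parity 1 (2 N.* X) (shape₁ X)))
       (factor-cong (+ 1) b₁ (oddPartsBelow-even (4 N.* X) (parity 0 (2 N.* X) (shape₀ X))))) ⟩
    factor (+ 1) b₃ (factor (+ 1) b₁ (oddPartsBelow (4 N.* X)))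
  ≈⟨ factor-cong (+ 1) b₃ (factor-cong (+ 1) b₁ (oddPartsBelow-four X)) ⟩
    factor (+ 1) b₃ (factor (+ 1) b₁ (prod (Gauss.zFactors X) (prod (Gauss.wFactors X) 𝟙)))
  ≈⟨ ≗-trans (factor-≡ (+ 1) (factor (+ 1) b₁ ZW) (NP.+-comm 3 (4 N.* X)))
       (factor-cong (+ 1) (4 N.* X N.+ 3) (≗-trans (factor-≡ (+ 1) ZW (NP.+-comm 1 (4 N.* X)))
         (≗-sym (prod-factor (Gauss.zFactors X) (+ 1) (4 N.* X N.+ 1) (prod (Gauss.wFactors X) 𝟙))))) ⟩
    prod (Gauss.zFactors (suc X)) (prod (Gauss.wFactors (suc X)) 𝟙)
  ∎
  where
  open ≗-Reasoning
  ZW : Series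
  ZW = prod (Gauss.zFactors X) (prod (Gauss.wFactors X) 𝟙)
  b₁ b₃ : ℕ
  b₁ = suc (4 N.* X)
  b₃ = suc (suc (suc (4 N.* X)))
  four-suc : ∀ X → 4 N.* suc X ≡ suc (suc (suc (suc (4 N.* X))))
  four-suc = NatSolver.solve-∀
  parity : ∀ r k {n} → n ≡ r N.+ k N.* 2 → n % 2 ≡ r % 2
  parity r k refl = [m+kn]%n≡m%n r k 2
  shape₃ : ∀ X → suc (suc (suc (4 N.* X))) ≡ 1 N.+ (2 N.* X N.+ 1) N.* 2
  shape₃ = NatSolver.solve-∀
  shape₂ : ∀ X → suc (suc (4 N.* X)) ≡ 0 N.+ (2 N.* X N.+ 1) N.* 2
  shape₂ = NatSolver.solve-∀
  shape₁ : ∀ X → suc (4 N.* X) ≡ 1 N.+ (2 N.* X) N.* 2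
  shape₁ = NatSolver.solve-∀
  shape₀ : ∀ X → 4 N.* X ≡ 0 N.+ (2 N.* X) N.* 2
  shape₀ = NatSolver.solve-∀

-- Below q^B, qq agrees with oddPartsBelow B: parts of a partition of m < B are < B.
qq-below : ∀ B → qq ≡[ + B ] oddPartsBelow B
qq-below B -[1+ k ] _ = refl
qq-below B (+ m) (+<+ m<B) with NP.m≤n⇒∃[o]m+o≡n m<B
... | k , refl = cong +_ (sym (stable m k))
  where
  stable-step : ∀ b m → m N.< b → length (dpartsBelow (suc b) m) ≡ length (dpartsBelow b m)
  stable-step b m m<b with b % 2 N.≟ 1 | b N.≤? m
  ... | yes _ | yes b≤m = ⊥-elim (NP.<⇒≱ m<b b≤m)
  ... | yes _ | no _ = refl
  ... | no _ | _ = refl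
  stable : ∀ m k → length (dpartsBelow (suc m N.+ k) m) ≡ qqℕ m
  stable m zero = cong (λ b → length (dpartsBelow b m)) (NP.+-identityʳ (suc m))
  stable m (suc k) =
    trans (cong (λ b → length (dpartsBelow b m)) (NP.+-suc (suc m) k))
      (trans (stable-step (suc m N.+ k) m (NP.≤-trans (NP.n<1+n m) (NP.m≤m+n (suc m) k))) (stable m k))

prod-pentSum : ∀ fs N f → prod fs (pentSum N f) ≗ pentSum N (prod fs f)
prod-pentSum fs zero f = prod-𝟘 fs
prod-pentSum fs (suc N) f =
  ≗-trans (prod-⊕ fs (pentSum N f) (pentTerm (suc N) f))
    (⊕-cong (prod-pentSum fs N f)
      (≗-trans (prod-· fs (sgn (suc N)) _)
        (·-cong (sgn (suc N)) (≗-trans (prod-⊕ fs _ _) (⊕-cong (prod-shift fs _ f) (prod-shift fs _ f))))))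

pentSum-cong : ∀ N {f g} → f ≗ g → pentSum N f ≗ pentSum N g
pentSum-cong zero p = ≗-refl
pentSum-cong (suc N) p =
  ⊕-cong (pentSum-cong N p) (·-cong (sgn (suc N)) (⊕-cong (shift-cong _ p) (shift-cong _ p)))

pentSum-≡[] : ∀ N {f g L} → f ≡[ L ] g → pentSum N f ≡[ L ] pentSum N g
pentSum-≡[] zero p = ≡[]-refl
pentSum-≡[] (suc N) p =
  ⊕-≡[] (pentSum-≡[] N p)
    (·-≡[] (sgn (suc N)) (⊕-≡[] (shift-≡[]-nonneg (+ pentExp⁻ (suc N)) (+≤+ z≤n) p)
                                 (shift-≡[]-nonneg (+ pentExp⁺ (suc N)) (+≤+ z≤n) p)))

lhs-as-coefficient : ∀ n → lhs n ≡ (qq ⊕ pentSum n qq) (+ n)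
lhs-as-coefficient n = cong (λ z → qq (+ n) + z) (partial n)
  where
  partial : ∀ N → partialSum n N ≡ pentSum N qq (+ n)
  partial zero = refl
  partial (suc N) = cong (λ z → z + term n (suc N)) (partial N)

-- The generating-function identity Q(q) E(q⁴) = Σ_k q^{T(k)}, modulo q^{n+1}; the products
-- are truncated at depth n = 3(n+1) factors of E(q⁴).
depth : ℕ → ℕ
depth n = 3 N.* suc n

generating-function : ∀ n → qq ⊕ pentSum n qq ≡[ + suc n ] triangularSeries (suc (depth n N.+ depth n))
generating-function n =
  ≡[]-trans (≡[]-weaken L≤B (⊕-≡[] (qq-below B) (pentSum-≡[] n (qq-below B))))
    (≡[]-trans (≗⇒≡[] L (≗-trans (⊕-cong (oddPartsBelow-four X) (pentSum-cong n (oddPartsBelow-four X))) (≗-sym distribute)))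
      (≡[]-trans (prod-≡[] Z (prod-≡[] W (pentagonal n)))
        (≡[]-trans (≗⇒≡[] L (≗-trans (prod-cong Z (prod-prod W (Gauss.pochFactors X) 𝟙))
                                      (prod-prod Z (Gauss.pochFactors X) (prod W 𝟙))))
          (≡[]-trans (Gauss.triple-product X (suc n) (NP.m≤n*m (suc n) 3))
            (≗⇒≡[] L (gauss-sum X))))))
  where
  X = depth n
  B = 4 N.* X
  L = + suc n
  Z = Gauss.zFactors X
  W = Gauss.wFactors X
  L≤B : L ≤ + B
  L≤B = +≤+ (NP.≤-trans (NP.m≤n*m (suc n) 3) (NP.m≤n*m X 4))
  distribute : prod Z (prod W (𝟙 ⊕ pentSum n 𝟙)) ≗ prod Z (prod W 𝟙) ⊕ pentSum n (prod Z (prod W 𝟙))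
  distribute = ≗-trans (prod-cong Z (prod-⊕ W 𝟙 (pentSum n 𝟙)))
                 (≗-trans (prod-⊕ Z (prod W 𝟙) (prod W (pentSum n 𝟙)))
                   (⊕-congʳ (prod Z (prod W 𝟙)) (≗-trans (prod-cong Z (prod-pentSum W n 𝟙)) (prod-pentSum Z n (prod W 𝟙)))))

private
  𝟙-shifted-other : ∀ n e → n ≢ e → shift (+ e) 𝟙 (+ n) ≡ + 0
  𝟙-shifted-other n e n≢e = nonzero (+ n - + e) (λ h → n≢e (ZP.+-injective (ZP.i-j≡0⇒i≡j (+ n) (+ e) h)))
    where
    nonzero : ∀ x → x ≢ + 0 → 𝟙 x ≡ + 0
    nonzero (+ zero) h = ⊥-elim (h refl)
    nonzero (+ suc _) h = refl
    nonzero -[1+ _ ] h = refl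

  𝟙-shifted-same : ∀ n → shift (+ n) 𝟙 (+ n) ≡ + 1
  𝟙-shifted-same n = cong 𝟙 (ZP.+-inverseʳ (+ n))

monomials-miss : ∀ n K (f : ℕ → ℕ) → (∀ k → k N.< K → f k ≢ n) → ∑ K (λ k → shift (+ f k) 𝟙) (+ n) ≡ + 0
monomials-miss n zero f miss = refl
monomials-miss n (suc K) f miss =
  cong₂ _+_ (𝟙-shifted-other n (f 0) (λ e → miss 0 (s≤s z≤n) (sym e)))
            (monomials-miss n K (f ∘ suc) (λ k lt → miss (suc k) (s≤s lt)))

monomials-hit : ∀ n K (f : ℕ → ℕ) → (∀ a b → a N.< b → f a N.< f b) →
                ∀ k₀ → k₀ N.< K → f k₀ ≡ n → ∑ K (λ k → shift (+ f k) 𝟙) (+ n) ≡ + 1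
monomials-hit n (suc K) f increasing zero _ refl =
  cong₂ _+_ (𝟙-shifted-same (f 0))
            (monomials-miss (f 0) K (f ∘ suc) (λ k _ e → NP.<-irrefl (sym e) (increasing 0 (suc k) (s≤s z≤n))))
monomials-hit n (suc K) f increasing (suc k₀) (s≤s k₀<K) refl =
  trans (cong₂ _+_ (𝟙-shifted-other (f (suc k₀)) (f 0) (λ e → NP.<-irrefl (sym e) (increasing 0 (suc k₀) (s≤s z≤n))))
                   (monomials-hit (f (suc k₀)) K (f ∘ suc) (λ a b a<b → increasing (suc a) (suc b) (s≤s a<b)) k₀ k₀<K refl))
        (ZP.+-identityˡ (+ 1))

tri-increasing : ∀ a b → a N.< b → tri a N.< tri b
tri-increasing a (suc b) (s≤s a≤b) with NP.m≤n⇒m<n∨m≡n a≤b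
... | inj₁ a<b = NP.<-≤-trans (tri-increasing a b a<b) (NP.m≤m+n (tri b) (suc b))
... | inj₂ refl = NP.m<m+n (tri a) (s≤s z≤n)

n≤tri : ∀ n → n N.≤ tri n
n≤tri zero = z≤n
n≤tri (suc n) = NP.m≤n+m (suc n) (tri n)

triangular⇒tri : ∀ {n k} → 2 N.* n ≡ k N.* (k N.+ 1) → tri k ≡ n
triangular⇒tri {n} {k} h =
  NP.*-cancelˡ-≡ (tri k) n 2 (trans (double-tri k) (trans (cong (k N.*_) (NP.+-comm 1 k)) (sym h)))

tri⇒triangular : ∀ {n} k → tri k ≡ n → Triangular n
tri⇒triangular {n} k refl = k , trans (double-tri k) (cong (k N.*_) (NP.+-comm 1 k))

theorem3p5 : (n : ℕ) → n ≥ 1 →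
    (Triangular n → lhs n ≡ + 1) × (¬ Triangular n → lhs n ≡ + 0)
theorem3p5 n _ = triangular , not-triangular
  where
  K = suc (depth n N.+ depth n)
  coefficient : lhs n ≡ triangularSeries K (+ n)
  coefficient = trans (lhs-as-coefficient n) (generating-function n (+ n) (+<+ (NP.n<1+n n)))
  n<K : n N.< K
  n<K = s≤s (NP.≤-trans (NP.≤-trans (NP.n≤1+n n) (NP.m≤n*m (suc n) 3)) (NP.m≤m+n (depth n) (depth n)))
  triangular : Triangular n → lhs n ≡ + 1
  triangular (k , h) =
    trans coefficient (monomials-hit n K tri tri-increasing k (NP.≤-<-trans (subst (k N.≤_) tk≡n (n≤tri k)) n<K) tk≡n)
    where
    tk≡n : tri k ≡ n
    tk≡n = triangular⇒tri {k = k} h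
  not-triangular : ¬ Triangular n → lhs n ≡ + 0
  not-triangular ¬T = trans coefficient (monomials-miss n K tri (λ k _ e → ¬T (tri⇒triangular k e)))
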